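{- Let $\mathcal{G}_{12,\mathrm{conn}}$ be the set of all permutations $\pi$ (of any length $n\ge 0$) such that the occurrence graph $G_{12}(\pi)$ is connected. Then \[ \mathcal{G}_{12,\mathrm{conn}} = \mathrm{Av}(m), \] where $m=(3412,R)$ is the mesh pattern with underlying permutation $3412$ and shaded box set \[ R=\{(0,0),(0,1),(1,0),(1,1),(2,0),(2,1),(3,2),(3,3),(3,4),(4,2),(4,3),(4,4)\}. \] Moreover, the generating function $\sum_{n\ge0} |\mathcal{G}_{12,\mathrm{conn}}\cap\mathfrak{S}_n|\,x^n$ equals \[ \frac{F(x)-x}{(1-x)^2} + \frac{1}{1-x},\qquad\text{where } F(x) = 1 - \frac{1}{\sum_{k\ge0} k!\,x^k} \] is the generating function of skew-indecomposable permutations.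
   Context: $\mathfrak{S}_n$ is the set of permutations of $\{1,\dots,n\}$. For a permutation $\pi$ of length $n$, $V_{12}(\pi)$ is the set of pairs $\{i,j\}$ with $1\le i<j\le n$ and $\pi(i)<\pi(j)$, and the occurrence graph $G_{12}(\pi)$ is the simple undirected graph with vertex set $V_{12}(\pi)$ in which two vertices are adjacent iff they share exactly one element. A graph is connected if any two vertices are joined by a path; in particular graphs with no vertices (e.g. $G_{12}(\pi)$ for decreasing $\pi$) count as connected. A mesh pattern $(\tau,R)$ consists of $\tau\in\mathfrak{S}_k$ and $R\subseteq\{0,\dots,k\}^2$. A permutation $\pi$ of length $n$ contains $(\tau,R)$ if there are indices $i_1<\dots<i_k$ with $\pi(i_1)\cdots\pi(i_k)$ order-isomorphic to $\tau$ such that, setting $i_0=0$, $i_{k+1}=n+1$, letting $v_1<\dots<v_k$ be the values $\pi(i_1),\dots,\pi(i_k)$ in increasing order and $v_0=0$, $v_{k+1}=n+1$, for every $(a,b)\in R$ there is no index $x$ with $i_a<x<i_{a+1}$ and $v_b<\pi(x)<v_{b+1}$. Otherwise $\pi$ avoids $(\tau,R)$, and $\mathrm{Av}(m)$ is the set of permutations avoiding $m$. A permutation is skew-indecomposable if it cannot be written as a skew sum $\alpha\ominus\beta$ of two nonempty permutations, where $\alpha\ominus\beta$ for $\alpha\in\mathfrak{S}_a,\beta\in\mathfrak{S}_b$ is the permutation of length $a+b$ given by $\alpha(i)+b$ for $i\le a$ and $\beta(i-a)$ for $i>a$. -}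

module Defs where

open import Data.Nat as ℕ using (ℕ; zero; suc; _+_; _<_; _!)
open import Data.Nat.Properties using (≤-decTotalOrder)
open import Data.Integer as ℤ using (ℤ; +_; -_)
open import Data.Fin as Fin using (Fin; toℕ)
open import Data.Vec using (Vec; lookup; _∷_; [])
open import Data.List as List using (List; _∷_; []; map; zipWith; upTo; _++_; [_]; allFin)
open import Data.List.Membership.Propositional using (_∈_)
open import Data.Product using (Σ; ∃; ∃-syntax; _×_; _,_)
open import Data.Bool using (if_then_else_)
open import Relation.Binary.PropositionalEquality using (_≡_; _≢_)
open import Relation.Binary.Construct.Closure.ReflexiveTransitive using (Star)
open import Relation.Nullary using (¬_)
open import Function.Bundles using (_⇔_)
open import Data.List.Sort ≤-decTotalOrder using (sort)

-- A permutation of length n is a word π ∈ Vec (Fin n) n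
-- (0-based values) that is injective (hence a bijection of Fin n).
-- Positions x : Fin n correspond to the paper's position toℕ x + 1 and
-- value lookup π x corresponds to the paper's value toℕ (lookup π x) + 1.

Word : ℕ → Set
Word n = Vec (Fin n) n

IsPerm : ∀ {n} → Word n → Set
IsPerm {n} π = ∀ (i j : Fin n) → lookup π i ≡ lookup π j → i ≡ j

pos : ∀ {n} → Fin n → ℕ
pos x = suc (toℕ x)

val : ∀ {n} → Word n → Fin n → ℕ
val π x = suc (toℕ (lookup π x))

record Vertex {n : ℕ} (π : Word n) : Set where
  constructor vtx
  field
    i j   : Fin n
    i<j   : i Fin.< j
    πi<πj : lookup π i Fin.< lookup π j

_∈₂_ : ∀ {n} {π : Word n} → Fin n → Vertex π → Set
x ∈₂ u = (x ≡ Vertex.i u) Data.Sum.⊎ (x ≡ Vertex.j u)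
  where import Data.Sum

Adj : ∀ {n} {π : Word n} → Vertex π → Vertex π → Set
Adj {n} u v = Σ (Fin n) λ x → (x ∈₂ u) × (x ∈₂ v) ×
                (∀ (y : Fin n) → y ∈₂ u → y ∈₂ v → y ≡ x)

Connected : ∀ {n} → Word n → Set
Connected π = ∀ (u v : Vertex π) → Star Adj u v

-- Mesh patterns (τ, R), τ ∈ 𝔖_k (0-based word), R ⊆ {0..k}² as a list

record MeshPattern : Set where
  constructor mesh
  field
    k : ℕ
    τ : Word k
    R : List (ℕ × ℕ)

at : List ℕ → ℕ → ℕ
at []       _       = 0
at (x ∷ xs) zero    = x
at (x ∷ xs) (suc m) = at xs m

Occurrence : ∀ {n} (m : MeshPattern) → Word n → (Fin (MeshPattern.k m) → Fin n) → Set
Occurrence {n} (mesh k τ R) π ι =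
  (∀ (c d : Fin k) → c Fin.< d → ι c Fin.< ι d) ×
  (∀ (c d : Fin k) → (val π (ι c) < val π (ι d)) ⇔ (lookup τ c Fin.< lookup τ d)) ×
  (∀ (a b : ℕ) → (a , b) ∈ R →
     ¬ (Σ (Fin n) λ x → (I a < pos x) × (pos x < I (suc a))
                       × (V b < val π x) × (val π x < V (suc b))))
  where
    I : ℕ → ℕ
    I = at (0 ∷ map (λ c → pos (ι c)) (allFin k) ++ [ suc n ])
    V : ℕ → ℕ
    V = at (0 ∷ sort (map (λ c → val π (ι c)) (allFin k)) ++ [ suc n ])

Contains : ∀ {n} → MeshPattern → Word n → Set
Contains {n} m π = Σ (Fin (MeshPattern.k m) → Fin n) λ ι → Occurrence m π ι

Avoids : ∀ {n} → MeshPattern → Word n → Set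
Avoids m π = ¬ Contains m π

m3412 : MeshPattern
m3412 = mesh 4 (Fin.suc (Fin.suc Fin.zero) ∷ Fin.suc (Fin.suc (Fin.suc Fin.zero))
                ∷ Fin.zero ∷ Fin.suc Fin.zero ∷ [])
          ((0 , 0) ∷ (0 , 1) ∷ (1 , 0) ∷ (1 , 1) ∷ (2 , 0) ∷ (2 , 1)
           ∷ (3 , 2) ∷ (3 , 3) ∷ (3 , 4) ∷ (4 , 2) ∷ (4 , 3) ∷ (4 , 4) ∷ [])

sumℤ : List ℤ → ℤ
sumℤ = List.foldr ℤ._+_ (+ 0)

-- invRev n = [b_n, b_{n-1}, …, b_0] where Σ b_n xⁿ = 1 / Σ_k k! xᵏ,
-- i.e. b_0 = 1 and b_{n+1} = - Σ_{i=1}^{n+1} i! · b_{n+1-i}.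
invRev : ℕ → List ℤ
invRev zero    = + 1 ∷ []
invRev (suc n) =
  let prev = invRev n in
  - sumℤ (zipWith (λ j b → + ((suc j) !) ℤ.* b) (upTo (suc n)) prev) ∷ prev

invCoeff : ℕ → ℤ
invCoeff n with invRev n
... | []    = + 0
... | b ∷ _ = b

δ : ℕ → ℕ → ℤ
δ a n = if (a ℕ.≡ᵇ n) then + 1 else + 0

-- [xⁿ] F(x),  F(x) = 1 - 1 / Σ_k k! xᵏ
F-coeff : ℕ → ℤ
F-coeff n = δ 0 n ℤ.- invCoeff n

-- [xⁿ] ( (F(x) - x)/(1-x)² + 1/(1-x) ) = Σ_{j=0}^n (n-j+1)(f_j - [j=1]) + 1
GF-coeff : ℕ → ℤ
GF-coeff n =
  sumℤ (map (λ j → + (suc (n ℕ.∸ j)) ℤ.* (F-coeff j ℤ.- δ 1 j)) (upTo (suc n)))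
  ℤ.+ + 1

module Submission where

-- Both parts rest on one notion.  A bad cut of π is a skew cut (every entry
-- left of position K lies above every entry from K on) with an ascent on each
-- side.  G₁₂(π) is connected iff π has no bad cut: an edge never crosses a
-- skew cut, and without bad cuts every gap is straddled by an ascent, which
-- chains overlapping ascents together.  π contains m iff π has a bad cut: an
-- occurrence of m is a bad cut at the position of its '1', and conversely the
-- left ascent, the first entry after a suitably shifted cut and the largest
-- entry after it form an occurrence.
--
-- For the count, write a permutation as σ ⊖ ρ with σ its skew-indecomposable
-- first block.  All permutations decompose this way, giving the recurrence
-- (n+1)! = f(n+1) + Σ_{j<n} f(n−j)·(j+1)! which makes 1 − F(x) the inverse
-- of Σ k! xᵏ.  The permutations without bad cuts of length n + 1 are exactly
-- 1 ⊖ ρ (ρ without bad cuts) and σ ⊖ δⱼ (σ indecomposable of length ≥ 2, δⱼ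
-- decreasing), which gives the same recurrence as the series.

open import Defs

module Basics where

  open import Data.Nat using (ℕ; _≤_; _<_)
  import Data.Nat.Properties as ℕP
  open import Data.Fin using (Fin; toℕ; fromℕ<)
  import Data.Fin.Properties as FinP
  open import Data.Vec using (Vec; lookup; tabulate)
  import Data.Vec.Properties as VecP
  open import Data.Product using (Σ; _×_)
  open import Relation.Nullary using (¬_; Dec)
  open import Relation.Nullary.Decidable using (_×-dec_; _→-dec_)
  open import Relation.Binary.PropositionalEquality

  value : ∀ {n} → Word n → Fin n → ℕ
  value π x = toℕ (lookup π x)

  module _ {n : ℕ} {π : Word n} (perm : IsPerm π) where

    value-injective : ∀ x y → value π x ≡ value π y → x ≡ y
    value-injective x y e = perm x y (FinP.toℕ-injective e)

    distinct-values : ∀ x y → toℕ x ≢ toℕ y → value π x ≢ value π y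
    distinct-values x y x≢y e = x≢y (cong toℕ (value-injective x y e))

  vec-ext : ∀ {A : Set} {n} {xs ys : Vec A n} → (∀ i → lookup xs i ≡ lookup ys i) → xs ≡ ys
  vec-ext {xs = xs} {ys} h = begin
    xs                   ≡⟨ VecP.tabulate∘lookup xs ⟨
    tabulate (lookup xs) ≡⟨ VecP.tabulate-cong h ⟩
    tabulate (lookup ys) ≡⟨ VecP.tabulate∘lookup ys ⟩
    ys                   ∎
    where open ≡-Reasoning

  word-ext : ∀ {n} {π π′ : Word n} → (∀ x → value π x ≡ value π′ x) → π ≡ π′
  word-ext h = vec-ext λ x → FinP.toℕ-injective (h x)

  injection-bound : ∀ {a b} (f : Fin a → ℕ) → (∀ i → f i < b) →
                    (∀ i j → f i ≡ f j → i ≡ j) → a ≤ b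
  injection-bound f f<b f-inj = FinP.injective⇒≤ {f = λ i → fromℕ< (f<b i)} λ {i} {j} e →
    f-inj i j (trans (sym (FinP.toℕ-fromℕ< (f<b i))) (trans (cong toℕ e) (FinP.toℕ-fromℕ< (f<b j))))

  SkewCut : ∀ {n} → Word n → ℕ → Set
  SkewCut {n} π K = ∀ (x y : Fin n) → toℕ x < K → K ≤ toℕ y → value π y < value π x

  AscentIn : ∀ {n} → Word n → ℕ → ℕ → Set
  AscentIn {n} π a b = Σ (Fin n) λ x → Σ (Fin n) λ y →
    (a ≤ toℕ x) × (toℕ x < toℕ y) × (toℕ y < b) × (value π x < value π y)

  -- A skew cut with an ascent on either side: exactly what disconnects G₁₂(π).
  BadCut : ∀ {n} → Word n → ℕ → Set
  BadCut {n} π K = SkewCut π K × AscentIn π 0 K × AscentIn π K n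

  NoBadCut : ∀ {n} → Word n → Set
  NoBadCut π = ∀ K → ¬ BadCut π K

  skewCut? : ∀ {n} (π : Word n) K → Dec (SkewCut π K)
  skewCut? π K = FinP.all? λ x → FinP.all? λ y →
    (toℕ x ℕP.<? K) →-dec ((K ℕP.≤? toℕ y) →-dec (value π y ℕP.<? value π x))

  ascentIn? : ∀ {n} (π : Word n) a b → Dec (AscentIn π a b)
  ascentIn? π a b = FinP.any? λ x → FinP.any? λ y →
    (a ℕP.≤? toℕ x) ×-dec ((toℕ x ℕP.<? toℕ y) ×-dec ((toℕ y ℕP.<? b) ×-dec (value π x ℕP.<? value π y)))

module OccurrenceGraph where

  open Basics
  open import Data.Nat using (ℕ; zero; suc; _+_; _≤_; _<_; z≤n; s≤s)
  import Data.Nat.Properties as ℕP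
  open import Data.Fin as Fin using (Fin; toℕ)
  import Data.Fin.Properties as FinP
  open import Data.Product using (Σ; _×_; _,_; proj₁; proj₂)
  open import Data.Sum using (_⊎_; inj₁; inj₂)
  open import Data.Empty using (⊥-elim)
  open import Relation.Nullary using (¬_; Dec; yes; no)
  open import Relation.Nullary.Decidable using (_×-dec_; decidable-stable)
  open import Relation.Binary.PropositionalEquality
  open import Function.Bundles using (_⇔_; mk⇔)
  open import Relation.Binary.Construct.Closure.ReflexiveTransitive as Star
    using (Star; ε; _◅_; _◅◅_)

  module _ {n : ℕ} {π : Word n} where

    open Vertex

    private
      Path : Vertex π → Vertex π → Set
      Path = Star (Adj {π = π})

    vertex-ext : ∀ {a b c d : Fin n} {p q p′ q′} → a ≡ c → b ≡ d →
                 vtx {π = π} a b p q ≡ vtx c d p′ q′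
    vertex-ext refl refl = cong₂ (vtx _ _) (ℕP.≤-irrelevant _ _) (ℕP.≤-irrelevant _ _)

    adj-sym : ∀ {u w : Vertex π} → Adj {π = π} u w → Adj {π = π} w u
    adj-sym (x , x∈u , x∈w , unique) = x , x∈w , x∈u , λ y y∈w y∈u → unique y y∈u y∈w

    path-sym : ∀ {u w : Vertex π} → Path u w → Path w u
    path-sym = Star.reverse (λ {u} {w} → adj-sym {u} {w})

    private
      same-pair : ∀ {a b c d x y : Fin n} → toℕ a < toℕ b → toℕ c < toℕ d →
                  (x ≡ a) ⊎ (x ≡ b) → (x ≡ c) ⊎ (x ≡ d) →
                  (y ≡ a) ⊎ (y ≡ b) → (y ≡ c) ⊎ (y ≡ d) → y ≢ x → (a ≡ c) × (b ≡ d)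
      same-pair a<b c<d (inj₁ refl) _ (inj₁ refl) _ y≢x = ⊥-elim (y≢x refl)
      same-pair a<b c<d (inj₂ refl) _ (inj₂ refl) _ y≢x = ⊥-elim (y≢x refl)
      same-pair a<b c<d _ (inj₁ refl) _ (inj₁ refl) y≢x = ⊥-elim (y≢x refl)
      same-pair a<b c<d _ (inj₂ refl) _ (inj₂ refl) y≢x = ⊥-elim (y≢x refl)
      same-pair a<b c<d (inj₁ refl) (inj₁ refl) (inj₂ refl) (inj₂ refl) _ = refl , refl
      same-pair a<b c<d (inj₁ refl) (inj₂ refl) (inj₂ refl) (inj₁ refl) _ = ⊥-elim (ℕP.<-asym a<b c<d)
      same-pair a<b c<d (inj₂ refl) (inj₁ refl) (inj₁ refl) (inj₂ refl) _ = ⊥-elim (ℕP.<-asym a<b c<d)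
      same-pair a<b c<d (inj₂ refl) (inj₂ refl) (inj₁ refl) (inj₁ refl) _ = refl , refl

    sharing-connected : ∀ (u w : Vertex π) (x : Fin n) → x ∈₂ u → x ∈₂ w → Path u w
    sharing-connected (vtx a b a<b _) (vtx c d c<d _) x x∈u x∈w with a Fin.≟ c | b Fin.≟ d
    ... | yes refl | yes refl = subst (Path _) (vertex-ext refl refl) ε
    ... | no a≢c | _ = (x , x∈u , x∈w , λ y y∈u y∈w → decidable-stable (y Fin.≟ x)
                         λ y≢x → a≢c (proj₁ (same-pair a<b c<d x∈u x∈w y∈u y∈w y≢x))) ◅ ε
    ... | yes _ | no b≢d = (x , x∈u , x∈w , λ y y∈u y∈w → decidable-stable (y Fin.≟ x)
                         λ y≢x → b≢d (proj₂ (same-pair a<b c<d x∈u x∈w y∈u y∈w y≢x))) ◅ ε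

    -- Vertices whose position intervals [i, j] overlap are joined by a path:
    -- either they share a position, or one of the pairs {iᵤ, j_w}, {i_w, jᵤ}
    -- is itself an ascent adjacent to both.
    overlapping-connected : IsPerm π → ∀ (u w : Vertex π) →
      toℕ (i u) ≤ toℕ (j w) → toℕ (i w) ≤ toℕ (j u) → Path u w
    overlapping-connected perm u@(vtx a b a<b πa<πb) w@(vtx c d c<d πc<πd) a≤d c≤b
      with a Fin.≟ d | c Fin.≟ b
    ... | yes a≡d | _ = sharing-connected u w a (inj₁ refl) (inj₂ a≡d)
    ... | no _ | yes c≡b = sharing-connected u w c (inj₂ c≡b) (inj₁ refl)
    ... | no a≢d | no c≢b with value π a ℕP.<? value π d
    ... | yes πa<πd = sharing-connected u ad a (inj₁ refl) (inj₁ refl)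
                      ◅◅ sharing-connected ad w d (inj₂ refl) (inj₂ refl)
      where
      ad : Vertex π
      ad = vtx a d (ℕP.≤∧≢⇒< a≤d (λ e → a≢d (FinP.toℕ-injective e))) πa<πd
    ... | no πa≮πd = sharing-connected u cb b (inj₂ refl) (inj₂ refl)
                     ◅◅ sharing-connected cb w c (inj₁ refl) (inj₁ refl)
      where
      πd<πa : value π d < value π a
      πd<πa = ℕP.≤∧≢⇒< (ℕP.≮⇒≥ πa≮πd)
                (distinct-values {π = π} perm d a (λ e → a≢d (FinP.toℕ-injective (sym e))))
      cb : Vertex π
      cb = vtx c b (ℕP.≤∧≢⇒< c≤b (λ e → c≢b (FinP.toℕ-injective e)))
               (ℕP.<-trans πc<πd (ℕP.<-trans πd<πa πa<πb))

    Straddle : ℕ → Set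
    Straddle K = Σ (Fin n) λ x → Σ (Fin n) λ y →
      (toℕ x < K) × (K ≤ toℕ y) × (value π x < value π y)

    straddle? : ∀ K → Dec (Straddle K)
    straddle? K = FinP.any? λ x → FinP.any? λ y →
      (toℕ x ℕP.<? K) ×-dec ((K ℕP.≤? toℕ y) ×-dec (value π x ℕP.<? value π y))

    no-straddle⇒skewCut : IsPerm π → ∀ K → ¬ Straddle K → SkewCut π K
    no-straddle⇒skewCut perm K none x y x<K K≤y =
      ℕP.≤∧≢⇒< (ℕP.≮⇒≥ λ πx<πy → none (x , y , x<K , K≤y , πx<πy))
        (distinct-values {π = π} perm y x λ e → ℕP.<-irrefl (sym e) (ℕP.<-≤-trans x<K K≤y))

    -- Without bad cuts, a vertex u reaches every vertex w whose interval
    -- [i_w, j_w) contains the position iᵤ + d: by induction on d, the gap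
    -- before iᵤ + d is straddled by an ascent reachable from u and
    -- overlapping w; an unstraddled gap would be a bad cut separating u and w.
    reach : IsPerm π → NoBadCut π → (u : Vertex π) → ∀ d (w : Vertex π) →
            toℕ (i w) ≤ toℕ (i u) + d → toℕ (i u) + d < toℕ (j w) → Path u w
    reach perm ok u zero w iw≤ <jw =
      overlapping-connected perm u w
        (ℕP.<⇒≤ (subst (_< toℕ (j w)) (ℕP.+-identityʳ _) <jw))
        (ℕP.≤-trans (subst (toℕ (i w) ≤_) (ℕP.+-identityʳ _) iw≤) (ℕP.<⇒≤ (i<j u)))
    reach perm ok u (suc d) w iw≤ <jw with straddle? K
      where K = suc (toℕ (i u) + d)
    ... | yes (x , y , x<K , K≤y , πx<πy) =
          reach perm ok u d s (ℕP.≤-pred x<K) (ℕP.<-≤-trans (ℕP.n<1+n _) K≤y)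
          ◅◅ overlapping-connected perm s w (ℕP.<⇒≤ (ℕP.<-≤-trans x<K (ℕP.<⇒≤ K<jw))) (ℕP.≤-trans iw≤K K≤y)
      where
      iw≤K : toℕ (i w) ≤ suc (toℕ (i u) + d)
      iw≤K = subst (toℕ (i w) ≤_) (ℕP.+-suc _ d) iw≤
      K<jw : suc (toℕ (i u) + d) < toℕ (j w)
      K<jw = subst (_< toℕ (j w)) (ℕP.+-suc _ d) <jw
      s : Vertex π
      s = vtx x y (ℕP.<-≤-trans x<K K≤y) πx<πy
    ... | no none = ⊥-elim (ok K (no-straddle⇒skewCut perm K none , left , right))
      where
      K = suc (toℕ (i u) + d)
      K<jw : K < toℕ (j w)
      K<jw = subst (_< toℕ (j w)) (ℕP.+-suc _ d) <jw
      left : AscentIn π 0 K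
      left = i u , j u , z≤n , i<j u ,
             ℕP.≰⇒> (λ K≤ju → none (i u , j u , s≤s (ℕP.m≤m+n _ d) , K≤ju , πi<πj u)) , πi<πj u
      right : AscentIn π K n
      right = i w , j w ,
              ℕP.≮⇒≥ (λ iw<K → none (i w , j w , iw<K , ℕP.<⇒≤ K<jw , πi<πj w)) ,
              i<j w , FinP.toℕ<n _ , πi<πj w

    noBadCut⇒connected : IsPerm π → NoBadCut π → Connected π
    noBadCut⇒connected perm ok u w with toℕ (i u) ℕP.≤? toℕ (i w)
    ... | yes iu≤iw = reach perm ok u _ w (ℕP.≤-reflexive (sym e)) (subst (_< toℕ (j w)) (sym e) (i<j w))
      where e = ℕP.m+[n∸m]≡n iu≤iw
    ... | no iu≰iw = path-sym (reach perm ok w _ u (ℕP.≤-reflexive (sym e)) (subst (_< toℕ (j u)) (sym e) (i<j u)))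
      where e = ℕP.m+[n∸m]≡n (ℕP.<⇒≤ (ℕP.≰⇒> iu≰iw))

    -- Across a skew cut at K, an edge never leaves the set of vertices lying
    -- entirely left of K; so ascents on the two sides are not connected.
    connected⇒noBadCut : Connected π → NoBadCut π
    connected⇒noBadCut conn K (cut , (x , y , _ , x<y , y<K , πx<πy) , (x′ , y′ , K≤x′ , x′<y′ , _ , πx′<πy′)) =
      ℕP.<-irrefl refl (ℕP.<-≤-trans (stays-left (conn u w) y<K) (ℕP.≤-trans K≤x′ (ℕP.<⇒≤ x′<y′)))
      where
      u w : Vertex π
      u = vtx x y x<y πx<πy
      w = vtx x′ y′ x′<y′ πx′<πy′
      Left : Vertex π → Set
      Left z = toℕ (j z) < K
      step : ∀ {z z′} → Adj {π = π} z z′ → Left z → Left z′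
      step {vtx a b a<b _} {vtx c d c<d πc<πd} (s , s∈z , s∈z′ , _) b<K = other s∈z′
        where
        left-of-K : (s ≡ a) ⊎ (s ≡ b) → toℕ s < K
        left-of-K (inj₁ refl) = ℕP.<-trans a<b b<K
        left-of-K (inj₂ refl) = b<K
        s<K : toℕ s < K
        s<K = left-of-K s∈z
        other : (s ≡ c) ⊎ (s ≡ d) → toℕ d < K
        other (inj₂ refl) = s<K
        other (inj₁ refl) = ℕP.≰⇒> λ K≤d → ℕP.<-asym πc<πd (cut s d s<K K≤d)
      stays-left : ∀ {z z′} → Path z z′ → Left z → Left z′
      stays-left ε l = l
      stays-left {z} (_◅_ {j = z′} e p) l = stays-left p (step {z} {z′} e l)

    connected⇔noBadCut : IsPerm π → Connected π ⇔ NoBadCut π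
    connected⇔noBadCut perm = mk⇔ connected⇒noBadCut (noBadCut⇒connected perm)

module PatternAvoidance where

  open Basics
  open import Data.Nat using (ℕ; zero; suc; _+_; _∸_; _≤_; _<_; z≤n; s≤s)
  import Data.Nat.Properties as ℕP
  open import Data.Nat.Properties using (≤-decTotalOrder; ≤-totalOrder)
  open import Data.Fin as Fin using (Fin; toℕ; fromℕ<)
  import Data.Fin.Properties as FinP
  open import Data.Vec using (lookup)
  open import Data.List as List using (List; _∷_; []; map; _++_; [_]; allFin)
  open import Data.List.Membership.Propositional using (_∈_; lose)
  open import Data.List.Membership.Propositional.Properties using (∈-filter⁺; ∈-allFin)
  open import Data.List.Relation.Unary.All.Properties using (all-filter)
  open import Data.List.Extrema.Nat using (argmax; argmax-all; v≤f[argmax]⁺)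
  open import Data.List.Relation.Unary.Any using (here; there)
  open import Data.List.Sort ≤-decTotalOrder using (sort; sort-↭; sort-↗)
  open import Data.List.Relation.Binary.Permutation.Propositional using (_↭_; ↭⇒↭ₛ; ↭-trans)
  open import Data.List.Relation.Binary.Permutation.Propositional.Properties using (++-comm)
  open import Data.List.Relation.Unary.Sorted.TotalOrder.Properties using (↗↭↗⇒≋)
  open import Data.List.Relation.Unary.Linked using (Linked; [-]; _∷_)
  open import Data.List.Relation.Binary.Pointwise using (Pointwise-≡⇒≡)
  open import Data.Product using (Σ; _×_; _,_; proj₁; proj₂)
  open import Data.Sum using (inj₁; inj₂)
  open import Data.Empty using (⊥; ⊥-elim)
  open import Relation.Nullary using (¬_; yes; no)
  open import Relation.Nullary.Decidable using (toWitness; _→-dec_)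
  open import Data.Unit using (tt)
  open import Relation.Binary.PropositionalEquality hiding ([_])
  open import Relation.Binary.Definitions using (tri<; tri≈; tri>)
  open import Function.Bundles using (_⇔_; mk⇔; Equivalence)

  sort-3412 : ∀ a b c d → c < d → d < a → a < b →
              sort (a ∷ b ∷ c ∷ d ∷ []) ≡ c ∷ d ∷ a ∷ b ∷ []
  sort-3412 a b c d c<d d<a a<b = Pointwise-≡⇒≡ (↗↭↗⇒≋ ≤-totalOrder (sort-↗ _) sorted (↭⇒↭ₛ perm))
    where
    sorted : Linked _≤_ (c ∷ d ∷ a ∷ b ∷ [])
    sorted = ℕP.<⇒≤ c<d ∷ ℕP.<⇒≤ d<a ∷ ℕP.<⇒≤ a<b ∷ [-]
    perm : sort (a ∷ b ∷ c ∷ d ∷ []) ↭ (c ∷ d ∷ a ∷ b ∷ [])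
    perm = ↭-trans (sort-↭ _) (++-comm (a ∷ b ∷ []) (c ∷ d ∷ []))

  τ : Word 4
  τ = MeshPattern.τ m3412

  R : List (ℕ × ℕ)
  R = MeshPattern.R m3412

  pattern f0 = Fin.zero
  pattern f1 = Fin.suc Fin.zero
  pattern f2 = Fin.suc (Fin.suc Fin.zero)
  pattern f3 = Fin.suc (Fin.suc (Fin.suc Fin.zero))

  pattern box00 = here refl
  pattern box01 = there box00
  pattern box10 = there box01
  pattern box11 = there box10
  pattern box20 = there box11
  pattern box21 = there box20
  pattern box32 = there box21
  pattern box33 = there box32
  pattern box34 = there box33
  pattern box42 = there box34
  pattern box43 = there box42
  pattern box44 = there box43

  increasing-4 : (g : Fin 4 → ℕ) → g f0 < g f1 → g f1 < g f2 → g f2 < g f3 →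
                 ∀ c d → toℕ c < toℕ d → g c < g d
  increasing-4 g p q r f0 f1 _ = p
  increasing-4 g p q r f0 f2 _ = ℕP.<-trans p q
  increasing-4 g p q r f0 f3 _ = ℕP.<-trans p (ℕP.<-trans q r)
  increasing-4 g p q r f1 f2 _ = q
  increasing-4 g p q r f1 f3 _ = ℕP.<-trans q r
  increasing-4 g p q r f2 f3 _ = r
  increasing-4 g p q r f0 f0 ()
  increasing-4 g p q r f1 f0 ()
  increasing-4 g p q r f1 f1 (s≤s ())
  increasing-4 g p q r f2 f0 ()
  increasing-4 g p q r f2 f1 (s≤s ())
  increasing-4 g p q r f2 f2 (s≤s (s≤s ()))
  increasing-4 g p q r f3 f0 ()
  increasing-4 g p q r f3 f1 (s≤s ())
  increasing-4 g p q r f3 f2 (s≤s (s≤s ()))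
  increasing-4 g p q r f3 f3 (s≤s (s≤s (s≤s ())))

  τ-injective : IsPerm τ
  τ-injective = toWitness {a? = FinP.all? λ c → FinP.all? λ d → (lookup τ c FinP.≟ lookup τ d) →-dec (c FinP.≟ d)} tt

  order-isomorphic-3412 : (g : Fin 4 → ℕ) → g f2 < g f3 → g f3 < g f0 → g f0 < g f1 →
                          ∀ c d → (g c < g d) ⇔ (lookup τ c Fin.< lookup τ d)
  order-isomorphic-3412 g p q r c d = mk⇔ (reflect c d) (preserve c d)
    where
    preserve : ∀ c d → lookup τ c Fin.< lookup τ d → g c < g d
    preserve f0 f1 _ = r
    preserve f2 f0 _ = ℕP.<-trans p q
    preserve f2 f1 _ = ℕP.<-trans p (ℕP.<-trans q r)
    preserve f2 f3 _ = p
    preserve f3 f0 _ = q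
    preserve f3 f1 _ = ℕP.<-trans q r
    preserve f0 f0 (s≤s (s≤s ()))
    preserve f0 f2 ()
    preserve f0 f3 (s≤s ())
    preserve f1 f0 (s≤s (s≤s ()))
    preserve f1 f1 (s≤s (s≤s (s≤s ())))
    preserve f1 f2 ()
    preserve f1 f3 (s≤s ())
    preserve f2 f2 ()
    preserve f3 f2 ()
    preserve f3 f3 (s≤s ())
    reflect : ∀ c d → g c < g d → lookup τ c Fin.< lookup τ d
    reflect c d gc<gd with FinP.<-cmp (lookup τ c) (lookup τ d)
    ... | tri< lt _ _ = lt
    ... | tri≈ _ e _ rewrite τ-injective c d e = ⊥-elim (ℕP.<-irrefl refl gc<gd)
    ... | tri> _ _ gt = ⊥-elim (ℕP.<-asym gc<gd (preserve d c gt))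

  module _ {n : ℕ} (π : Word n) (ι : Fin 4 → Fin n) where

    column : ℕ → ℕ
    column = at (0 ∷ map (λ c → pos (ι c)) (allFin 4) ++ [ suc n ])

    row : List ℕ → ℕ → ℕ
    row S = at (0 ∷ S ++ [ suc n ])

    ShadedEmpty : List ℕ → Set
    ShadedEmpty S = ∀ (a b : ℕ) → (a , b) ∈ R →
      ¬ (Σ (Fin n) λ x → (column a < pos x) × (pos x < column (suc a))
                        × (row S b < val π x) × (val π x < row S (suc b)))

  module _ {n : ℕ} {π : Word n} where

    occurrence : (i₀ i₁ i₂ i₃ : Fin n) →
      toℕ i₀ < toℕ i₁ → toℕ i₁ < toℕ i₂ → toℕ i₂ < toℕ i₃ →
      value π i₂ < value π i₃ → value π i₃ < value π i₀ → value π i₀ < value π i₁ →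
      (∀ x → toℕ x < toℕ i₂ → value π i₃ < value π x) →
      (∀ x → toℕ i₂ < toℕ x → value π x ≤ value π i₃) →
      Contains m3412 π
    occurrence i₀ i₁ i₂ i₃ o01 o12 o23 v23 v30 v01 above below =
      ι , increasing-4 (λ c → toℕ (ι c)) o01 o12 o23 ,
      order-isomorphic-3412 (λ c → val π (ι c)) (s≤s v23) (s≤s v30) (s≤s v01) ,
      subst (ShadedEmpty π ι) (sym (sort-3412 _ _ _ _ (s≤s v23) (s≤s v30) (s≤s v01))) shaded
      where
      ι : Fin 4 → Fin n
      ι f0 = i₀
      ι f1 = i₁
      ι f2 = i₂
      ι f3 = i₃
      left : ∀ x → pos x < pos i₂ → val π x < val π i₃ → ⊥
      left x x<i₂ πx<πi₃ = ℕP.<-asym (above x (ℕP.≤-pred x<i₂)) (ℕP.≤-pred πx<πi₃)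
      right : ∀ x → pos i₂ < pos x → val π i₃ < val π x → ⊥
      right x i₂<x πi₃<πx = ℕP.<⇒≱ (ℕP.≤-pred πi₃<πx) (below x (ℕP.≤-pred i₂<x))
      p02 : pos i₀ < pos i₂
      p02 = s≤s (ℕP.<-trans o01 o12)
      p12 : pos i₁ < pos i₂
      p12 = s≤s o12
      p23 : pos i₂ < pos i₃
      p23 = s≤s o23
      w23 : val π i₂ < val π i₃
      w23 = s≤s v23
      w30 : val π i₃ < val π i₀
      w30 = s≤s v30
      w31 : val π i₃ < val π i₁
      w31 = s≤s (ℕP.<-trans v30 v01)
      -- Boxes in columns 0–2 and rows 0–1 lie left of i₂ and below π(i₃);
      -- boxes in columns 3–4 and rows 2–4 lie right of i₂ and above π(i₃).
      shaded : ShadedEmpty π ι (val π i₂ ∷ val π i₃ ∷ val π i₀ ∷ val π i₁ ∷ [])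
      shaded .0 .0 box00 (x , _ , x< , _ , <v) = left x (ℕP.<-trans x< p02) (ℕP.<-trans <v w23)
      shaded .0 .1 box01 (x , _ , x< , _ , <v) = left x (ℕP.<-trans x< p02) <v
      shaded .1 .0 box10 (x , _ , x< , _ , <v) = left x (ℕP.<-trans x< p12) (ℕP.<-trans <v w23)
      shaded .1 .1 box11 (x , _ , x< , _ , <v) = left x (ℕP.<-trans x< p12) <v
      shaded .2 .0 box20 (x , _ , x< , _ , <v) = left x x< (ℕP.<-trans <v w23)
      shaded .2 .1 box21 (x , _ , x< , _ , <v) = left x x< <v
      shaded .3 .2 box32 (x , <x , _ , v< , _) = right x <x v<
      shaded .3 .3 box33 (x , <x , _ , v< , _) = right x <x (ℕP.<-trans w30 v<)
      shaded .3 .4 box34 (x , <x , _ , v< , _) = right x <x (ℕP.<-trans w31 v<)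
      shaded .4 .2 box42 (x , <x , _ , v< , _) = right x (ℕP.<-trans p23 <x) v<
      shaded .4 .3 box43 (x , <x , _ , v< , _) = right x (ℕP.<-trans p23 <x) (ℕP.<-trans w30 v<)
      shaded .4 .4 box44 (x , <x , _ , v< , _) = right x (ℕP.<-trans p23 <x) (ℕP.<-trans w31 v<)

  -- The consequences of the shading for an occurrence ι of m: every entry left
  -- of the '1' (at ι₂) lies above the '2' (at ι₃), and every entry from the '1'
  -- on is at most the '2'.
  module ShadingConsequences {n : ℕ} {π : Word n} (perm : IsPerm π) (ι : Fin 4 → Fin n)
                             (occ : Occurrence m3412 π ι) where

    private
      increasing = proj₁ occ
      g : Fin 4 → ℕ
      g c = val π (ι c)

    g23 : g f2 < g f3
    g23 = Equivalence.from (proj₁ (proj₂ occ) f2 f3) (s≤s z≤n)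
    g30 : g f3 < g f0
    g30 = Equivalence.from (proj₁ (proj₂ occ) f3 f0) (s≤s (s≤s z≤n))
    g01 : g f0 < g f1
    g01 = Equivalence.from (proj₁ (proj₂ occ) f0 f1) (s≤s (s≤s (s≤s z≤n)))

    private
      empty : ShadedEmpty π ι (g f2 ∷ g f3 ∷ g f0 ∷ g f1 ∷ [])
      empty = subst (ShadedEmpty π ι) (sort-3412 _ _ _ _ g23 g30 g01) (proj₂ (proj₂ occ))
      not-at : ∀ x c → toℕ x ≢ toℕ (ι c) → val π x ≢ g c
      not-at x c ne e = distinct-values {π = π} perm x (ι c) ne (ℕP.suc-injective e)

    low-column : ∀ a → (a , 0) ∈ R → (a , 1) ∈ R → ∀ x → column π ι a < pos x →
                 pos x < column π ι (suc a) → toℕ x < toℕ (ι f2) → value π (ι f3) < value π x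
    low-column a r0 r1 x c< <c x<ι2 with ℕP.<-cmp (val π x) (g f2)
    ... | tri< lt _ _ = ⊥-elim (empty a 0 r0 (x , c< , <c , s≤s z≤n , lt))
    ... | tri≈ _ e _ = ⊥-elim (not-at x f2 (λ e′ → ℕP.<-irrefl e′ x<ι2) e)
    ... | tri> _ _ gt with ℕP.<-cmp (val π x) (g f3)
    ...   | tri< lt _ _ = ⊥-elim (empty a 1 r1 (x , c< , <c , gt , lt))
    ...   | tri≈ _ e _ = ⊥-elim (not-at x f3 (λ e′ → ℕP.<-irrefl e′
                           (ℕP.<-trans x<ι2 (increasing f2 f3 (s≤s (s≤s (s≤s z≤n)))))) e)
    ...   | tri> _ _ gt′ = ℕP.≤-pred gt′

    high-column : ∀ a → (a , 2) ∈ R → (a , 3) ∈ R → (a , 4) ∈ R → ∀ x → column π ι a < pos x →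
                  pos x < column π ι (suc a) → toℕ (ι f2) < toℕ x → value π x ≤ value π (ι f3)
    high-column a r2 r3 r4 x c< <c ι2<x with ℕP.≤-<-connex (val π x) (g f3)
    ... | inj₁ le = ℕP.≤-pred le
    ... | inj₂ gt with ℕP.<-cmp (val π x) (g f0)
    ...   | tri< lt _ _ = ⊥-elim (empty a 2 r2 (x , c< , <c , gt , lt))
    ...   | tri≈ _ e _ = ⊥-elim (not-at x f0 (λ e′ → ℕP.<-irrefl (sym e′)
                           (ℕP.<-trans (increasing f0 f2 (s≤s z≤n)) ι2<x)) e)
    ...   | tri> _ _ gt0 with ℕP.<-cmp (val π x) (g f1)
    ...     | tri< lt _ _ = ⊥-elim (empty a 3 r3 (x , c< , <c , gt0 , lt))
    ...     | tri≈ _ e _ = ⊥-elim (not-at x f1 (λ e′ → ℕP.<-irrefl (sym e′)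
                             (ℕP.<-trans (increasing f1 f2 (s≤s (s≤s z≤n))) ι2<x)) e)
    ...     | tri> _ _ gt1 = ⊥-elim (empty a 4 r4 (x , c< , <c , gt1 , s≤s (FinP.toℕ<n _)))

    -- Left of ι₂ an entry is ι₀, ι₁, or inside column 0, 1 or 2.
    above-left : ∀ x → toℕ x < toℕ (ι f2) → value π (ι f3) < value π x
    above-left x x<ι2 with ℕP.<-cmp (toℕ x) (toℕ (ι f0))
    ... | tri< lt _ _ = low-column 0 box00 box01 x (s≤s z≤n) (s≤s lt) x<ι2
    ... | tri≈ _ e _ rewrite FinP.toℕ-injective e = ℕP.≤-pred g30
    ... | tri> _ _ gt with ℕP.<-cmp (toℕ x) (toℕ (ι f1))
    ...   | tri< lt _ _ = low-column 1 box10 box11 x (s≤s gt) (s≤s lt) x<ι2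
    ...   | tri≈ _ e _ rewrite FinP.toℕ-injective e = ℕP.<-trans (ℕP.≤-pred g30) (ℕP.≤-pred g01)
    ...   | tri> _ _ gt′ = low-column 2 box20 box21 x (s≤s gt′) (s≤s x<ι2) x<ι2

    -- From ι₂ on an entry is ι₂, ι₃, or inside column 3 or 4.
    below-right : ∀ x → toℕ (ι f2) ≤ toℕ x → value π x ≤ value π (ι f3)
    below-right x ι2≤x with ℕP.<-cmp (toℕ x) (toℕ (ι f2))
    ... | tri< lt _ _ = ⊥-elim (ℕP.<⇒≱ lt ι2≤x)
    ... | tri≈ _ e _ rewrite FinP.toℕ-injective e = ℕP.<⇒≤ (ℕP.≤-pred g23)
    ... | tri> _ _ gt with ℕP.<-cmp (toℕ x) (toℕ (ι f3))
    ...   | tri< lt _ _ = high-column 3 box32 box33 box34 x (s≤s gt) (s≤s lt) gt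
    ...   | tri≈ _ e _ rewrite FinP.toℕ-injective e = ℕP.≤-refl
    ...   | tri> _ _ gt′ = high-column 4 box42 box43 box44 x (s≤s gt′) (s≤s (FinP.toℕ<n x)) gt

  -- An occurrence of m yields a bad cut at the position of its '1': the entries
  -- left of it lie above those from it on, and '34' and '12' are the two ascents.
  occurrence⇒badCut : ∀ {n} {π : Word n} → IsPerm π → Contains m3412 π → Σ ℕ (BadCut π)
  occurrence⇒badCut {π = π} perm (ι , occ@(increasing , _)) =
    toℕ (ι f2) , (λ x y x<K K≤y → ℕP.≤-<-trans (below-right y K≤y) (above-left x x<K)) ,
    (ι f0 , ι f1 , z≤n , increasing f0 f1 (s≤s z≤n) , increasing f1 f2 (s≤s (s≤s z≤n)) , ℕP.≤-pred g01) ,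
    (ι f2 , ι f3 , ℕP.≤-refl , increasing f2 f3 (s≤s (s≤s (s≤s z≤n))) , FinP.toℕ<n _ , ℕP.≤-pred g23)
    where open ShadingConsequences {π = π} perm ι occ

  maximum-from : ∀ {n} (π : Word n) K (x : Fin n) → K ≤ toℕ x →
                 Σ (Fin n) λ q → (K ≤ toℕ q) × (∀ y → K ≤ toℕ y → value π y ≤ value π q)
  maximum-from {n} π K x K≤x =
    q , argmax-all (value π) K≤x (all-filter (λ z → K ℕP.≤? toℕ z) (allFin n)) ,
    λ y K≤y → v≤f[argmax]⁺ x candidates (inj₂ (lose (∈-filter⁺ _ (∈-allFin y) K≤y) ℕP.≤-refl))
    where
    candidates : List (Fin n)
    candidates = List.filter (λ z → K ℕP.≤? toℕ z) (allFin n)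
    q : Fin n
    q = argmax (value π) x candidates

  module _ {n : ℕ} {π : Word n} (perm : IsPerm π) where

    skewCut-step : ∀ {K} (q : Fin n) → toℕ q ≡ K → (∀ y → K ≤ toℕ y → value π y ≤ value π q) →
                   SkewCut π K → SkewCut π (suc K)
    skewCut-step {K} q q≡K q-max cut x y x<K+1 K+1≤y with ℕP.<-cmp (toℕ x) K
    ... | tri< x<K _ _ = cut x y x<K (ℕP.<⇒≤ K+1≤y)
    ... | tri> _ _ x>K = ⊥-elim (ℕP.<⇒≱ x<K+1 x>K)
    ... | tri≈ _ x≡K _ rewrite FinP.toℕ-injective {i = x} {j = q} (trans x≡K (sym q≡K)) =
          ℕP.≤∧≢⇒< (q-max y (ℕP.<⇒≤ K+1≤y))
            (distinct-values {π = π} perm y q λ e → ℕP.<-irrefl (sym (trans e q≡K)) K+1≤y)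

    -- A bad cut yields an occurrence of m: move the cut right while the largest
    -- entry after it comes first; once it does not, the left ascent, the entry
    -- right after the cut and that largest entry form an occurrence.
    -- (d is the distance from the cut to the end.)
    badCut⇒occurrence : ∀ d K → K + d ≡ n → BadCut π K → Contains m3412 π
    badCut⇒occurrence d K K+d≡n (cut , left@(x , y , _ , x<y , y<K , πx<πy) , (x′ , y′ , K≤x′ , x′<y′ , _ , πx′<πy′))
      with maximum-from π K x′ K≤x′
    ... | q , K≤q , q-max with toℕ q ℕP.≟ K
    ...   | no q≢K = occurrence {π = π} x y c q x<y (subst (toℕ y <_) (sym c≡K) y<K) c<q πc<πq
                     (cut x q (ℕP.<-trans x<y y<K) K≤q) πx<πy
                     (λ z z<c → cut z q (subst (toℕ z <_) c≡K z<c) K≤q)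
                     (λ z c<z → q-max z (ℕP.<⇒≤ (subst (_< toℕ z) c≡K c<z)))
      where
      K<n : K < n
      K<n = ℕP.≤-<-trans K≤x′ (FinP.toℕ<n x′)
      c : Fin n
      c = fromℕ< K<n
      c≡K : toℕ c ≡ K
      c≡K = FinP.toℕ-fromℕ< K<n
      c<q : toℕ c < toℕ q
      c<q = subst (_< toℕ q) (sym c≡K) (ℕP.≤∧≢⇒< K≤q (λ e → q≢K (sym e)))
      πc<πq : value π c < value π q
      πc<πq = ℕP.≤∧≢⇒< (q-max c (ℕP.≤-reflexive (sym c≡K)))
                (distinct-values {π = π} perm c q λ e → ℕP.<-irrefl e c<q)
    ...   | yes q≡K = shift d K+d≡n
      where
      K<x′ : K < toℕ x′
      K<x′ = ℕP.≤∧≢⇒< K≤x′ λ K≡x′ → ℕP.<⇒≱ πx′<πy′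
        (subst (λ t → value π y′ ≤ value π t) (FinP.toℕ-injective {i = q} {j = x′} (trans q≡K K≡x′))
          (q-max y′ (ℕP.≤-trans K≤x′ (ℕP.<⇒≤ x′<y′))))
      shift : ∀ d → K + d ≡ n → Contains m3412 π
      shift zero K+0≡n = ⊥-elim (ℕP.<-irrefl (trans (sym (ℕP.+-identityʳ K)) K+0≡n)
                                  (ℕP.<-trans K<x′ (FinP.toℕ<n x′)))
      shift (suc d′) K+d≡n′ = badCut⇒occurrence d′ (suc K) (trans (sym (ℕP.+-suc K d′)) K+d≡n′)
        ( skewCut-step q q≡K q-max cut
        , (x , y , z≤n , x<y , ℕP.<-trans y<K (ℕP.n<1+n K) , πx<πy)
        , (x′ , y′ , K<x′ , x′<y′ , FinP.toℕ<n y′ , πx′<πy′))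

    avoids⇔noBadCut : Avoids m3412 π ⇔ NoBadCut π
    avoids⇔noBadCut = mk⇔ (λ avoid K bad → avoid (badCut⇒occurrence (n ∸ K) K (ℕP.m+[n∸m]≡n (K≤n bad)) bad))
                          (λ ok occ → let (K , bad) = occurrence⇒badCut {π = π} perm occ in ok K bad)
      where
      K≤n : ∀ {K} → BadCut π K → K ≤ n
      K≤n (_ , _ , (x′ , _ , K≤x′ , _)) = ℕP.≤-trans K≤x′ (ℕP.<⇒≤ (FinP.toℕ<n x′))

module SkewSums where

  open Basics
  open import Data.Nat using (ℕ; suc; _+_; _∸_; _≤_; _<_)
  import Data.Nat.Properties as ℕP
  open import Data.Fin using (Fin; toℕ; fromℕ<; inject≤)
  import Data.Fin.Properties as FinP
  open import Data.Vec using (lookup; tabulate)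
  import Data.Vec.Properties as VecP
  open import Data.Product using (Σ; _×_; _,_)
  open import Data.Sum using (_⊎_; inj₁; inj₂)
  open import Data.Empty using (⊥-elim)
  open import Relation.Nullary using (yes; no)
  open import Relation.Binary.PropositionalEquality

  -- The skew sum σ ⊖ ρ of σ ∈ 𝔖ₖ and ρ ∈ 𝔖ₘ, as a word of length N = k + m:
  -- σ shifted up by m on the first k positions, followed by ρ.  The equation
  -- k + m ≡ N is a parameter so that the length can be any expression.
  module SkewSum {k m N : ℕ} (e : k + m ≡ N) where

    k≤N : k ≤ N
    k≤N = subst (k ≤_) e (ℕP.m≤m+n k m)

    m≤N : m ≤ N
    m≤N = subst (m ≤_) e (ℕP.m≤n+m m k)

    posL : Fin k → Fin N
    posL i = inject≤ i k≤N

    posL-toℕ : ∀ i → toℕ (posL i) ≡ toℕ i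
    posL-toℕ i = FinP.toℕ-inject≤ i k≤N

    posR-bound : ∀ (j : Fin m) → k + toℕ j < N
    posR-bound j = subst (k + toℕ j <_) e (ℕP.+-monoʳ-< k (FinP.toℕ<n j))

    posR : Fin m → Fin N
    posR j = fromℕ< (posR-bound j)

    posR-toℕ : ∀ j → toℕ (posR j) ≡ k + toℕ j
    posR-toℕ j = FinP.toℕ-fromℕ< (posR-bound j)

    viewL : ∀ (x : Fin N) → toℕ x < k → Σ (Fin k) λ i → toℕ x ≡ toℕ i
    viewL x h = fromℕ< h , sym (FinP.toℕ-fromℕ< h)

    x∸k<m : ∀ (x : Fin N) → k ≤ toℕ x → toℕ x ∸ k < m
    x∸k<m x h = subst (toℕ x ∸ k <_) (ℕP.m+n∸m≡n k m)
                  (ℕP.∸-monoˡ-< (subst (toℕ x <_) (sym e) (FinP.toℕ<n x)) h)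

    viewR : ∀ (x : Fin N) → k ≤ toℕ x → Σ (Fin m) λ j → toℕ x ≡ k + toℕ j
    viewR x h = fromℕ< (x∸k<m x h) ,
      trans (sym (ℕP.m+[n∸m]≡n h)) (cong (k +_) (sym (FinP.toℕ-fromℕ< (x∸k<m x h))))

    boundL : (σ : Word k) (i : Fin k) → value σ i + m < N
    boundL σ i = subst (value σ i + m <_) e (ℕP.+-monoˡ-< m (FinP.toℕ<n (lookup σ i)))

    boundR : (ρ : Word m) (j : Fin m) → value ρ j < N
    boundR ρ j = ℕP.<-≤-trans (FinP.toℕ<n (lookup ρ j)) m≤N

    skew-entry : Word k → Word m → Fin N → Fin N
    skew-entry σ ρ x with toℕ x ℕP.<? k
    ... | yes h = fromℕ< (boundL σ (fromℕ< h))
    ... | no h = fromℕ< (boundR ρ (fromℕ< (x∸k<m x (ℕP.≮⇒≥ h))))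

    skew : Word k → Word m → Word N
    skew σ ρ = tabulate (skew-entry σ ρ)

    value-left : ∀ σ ρ (x : Fin N) (i : Fin k) → toℕ x ≡ toℕ i → value (skew σ ρ) x ≡ value σ i + m
    value-left σ ρ x i hx rewrite VecP.lookup∘tabulate (skew-entry σ ρ) x with toℕ x ℕP.<? k
    ... | yes h = trans (FinP.toℕ-fromℕ< (boundL σ (fromℕ< h)))
                    (cong (λ t → value σ t + m) (FinP.toℕ-injective (trans (FinP.toℕ-fromℕ< h) hx)))
    ... | no h = ⊥-elim (h (subst (_< k) (sym hx) (FinP.toℕ<n i)))

    value-right : ∀ σ ρ (x : Fin N) (j : Fin m) → toℕ x ≡ k + toℕ j → value (skew σ ρ) x ≡ value ρ j
    value-right σ ρ x j hx rewrite VecP.lookup∘tabulate (skew-entry σ ρ) x with toℕ x ℕP.<? k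
    ... | yes h = ⊥-elim (ℕP.<⇒≱ h (subst (k ≤_) (sym hx) (ℕP.m≤m+n k (toℕ j))))
    ... | no h = trans (FinP.toℕ-fromℕ< (boundR ρ _))
                   (cong (value ρ) (FinP.toℕ-injective (trans (FinP.toℕ-fromℕ< (x∸k<m x (ℕP.≮⇒≥ h)))
                      (trans (cong (_∸ k) hx) (ℕP.m+n∸m≡n k (toℕ j))))))

    value-posL : ∀ σ ρ i → value (skew σ ρ) (posL i) ≡ value σ i + m
    value-posL σ ρ i = value-left σ ρ (posL i) i (posL-toℕ i)

    value-posR : ∀ σ ρ j → value (skew σ ρ) (posR j) ≡ value ρ j
    value-posR σ ρ j = value-right σ ρ (posR j) j (posR-toℕ j)

    position-split : ∀ (x : Fin N) → (Σ (Fin k) λ i → toℕ x ≡ toℕ i) ⊎ (Σ (Fin m) λ j → toℕ x ≡ k + toℕ j)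
    position-split x with toℕ x ℕP.<? k
    ... | yes h = inj₁ (viewL x h)
    ... | no h = inj₂ (viewR x (ℕP.≮⇒≥ h))

    private
      ltk : ∀ (i : Fin k) → toℕ i < k
      ltk = FinP.toℕ<n
      gek : ∀ (j : Fin m) → k ≤ k + toℕ j
      gek j = ℕP.m≤m+n k (toℕ j)
      value<m : ∀ (ρ : Word m) j → value ρ j < m
      value<m ρ j = FinP.toℕ<n (lookup ρ j)

    skew-perm : ∀ {σ ρ} → IsPerm σ → IsPerm ρ → IsPerm (skew σ ρ)
    skew-perm {σ} {ρ} Pσ Pρ x y eq = FinP.toℕ-injective (go (position-split x) (position-split y))
      where
      ev : value (skew σ ρ) x ≡ value (skew σ ρ) y
      ev = cong toℕ eq
      go : _ → _ → toℕ x ≡ toℕ y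
      go (inj₁ (i , hx)) (inj₁ (i' , hy)) =
        trans hx (trans (cong toℕ (value-injective {π = σ} Pσ i i' (ℕP.+-cancelʳ-≡ _ _ _
          (trans (sym (value-left σ ρ x i hx)) (trans ev (value-left σ ρ y i' hy)))))) (sym hy))
      go (inj₁ (i , hx)) (inj₂ (j , hy)) = ⊥-elim (ℕP.<⇒≱ (value<m ρ j)
          (subst (m ≤_) (trans (sym (value-left σ ρ x i hx)) (trans ev (value-right σ ρ y j hy))) (ℕP.m≤n+m m _)))
      go (inj₂ (j , hx)) (inj₁ (i , hy)) = ⊥-elim (ℕP.<⇒≱ (value<m ρ j)
          (subst (m ≤_) (trans (sym (value-left σ ρ y i hy)) (trans (sym ev) (value-right σ ρ x j hx))) (ℕP.m≤n+m m _)))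
      go (inj₂ (j , hx)) (inj₂ (j' , hy)) =
        trans hx (trans (cong (λ t → k + toℕ t) (value-injective {π = ρ} Pρ j j'
          (trans (sym (value-right σ ρ x j hx)) (trans ev (value-right σ ρ y j' hy))))) (sym hy))

    skew-inj : ∀ {σ σ' ρ ρ'} → skew σ ρ ≡ skew σ' ρ' → (σ ≡ σ') × (ρ ≡ ρ')
    skew-inj {σ} {σ'} {ρ} {ρ'} eq =
      word-ext (λ i → ℕP.+-cancelʳ-≡ _ _ _ (trans (sym (value-posL σ ρ i)) (trans (cong (λ w → value w (posL i)) eq) (value-posL σ' ρ' i)))) ,
      word-ext (λ j → trans (sym (value-posR σ ρ j)) (trans (cong (λ w → value w (posR j)) eq) (value-posR σ' ρ' j)))

    skewCut-middle : ∀ σ ρ → SkewCut (skew σ ρ) k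
    skewCut-middle σ ρ x y xk ky with viewL x xk | viewR y ky
    ... | i , hx | j , hy rewrite value-left σ ρ x i hx | value-right σ ρ y j hy =
          ℕP.<-≤-trans (value<m ρ j) (ℕP.m≤n+m m _)

    skewCut-left⁺ : ∀ σ ρ K → K ≤ k → SkewCut σ K → SkewCut (skew σ ρ) K
    skewCut-left⁺ σ ρ K Kk c x y xK Ky with position-split y
    ... | inj₂ (j , hy) = skewCut-middle σ ρ x y (ℕP.<-≤-trans xK Kk) (subst (k ≤_) (sym hy) (gek j))
    ... | inj₁ (i' , hy) with viewL x (ℕP.<-≤-trans xK Kk)
    ...   | i , hx rewrite value-left σ ρ x i hx | value-left σ ρ y i' hy =
            ℕP.+-monoˡ-< m (c i i' (subst (_< K) hx xK) (subst (K ≤_) hy Ky))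

    skewCut-left⁻ : ∀ σ ρ K → K ≤ k → SkewCut (skew σ ρ) K → SkewCut σ K
    skewCut-left⁻ σ ρ K Kk c i i' iK Ki' = ℕP.+-cancelʳ-< _ _ _ (subst₂ _<_ (value-posL σ ρ i') (value-posL σ ρ i)
        (c (posL i) (posL i') (subst (_< K) (sym (posL-toℕ i)) iK) (subst (K ≤_) (sym (posL-toℕ i')) Ki')))

    skewCut-right⁺ : ∀ σ ρ K → SkewCut ρ K → SkewCut (skew σ ρ) (k + K)
    skewCut-right⁺ σ ρ K c x y xK Ky with viewR y (ℕP.≤-trans (ℕP.m≤m+n k K) Ky)
    ... | j' , hy with position-split x
    ...   | inj₁ (i , hx) = skewCut-middle σ ρ x y (subst (_< k) (sym hx) (ltk i)) (subst (k ≤_) (sym hy) (gek j'))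
    ...   | inj₂ (j , hx) rewrite value-right σ ρ x j hx | value-right σ ρ y j' hy =
            c j j' (ℕP.+-cancelˡ-< k _ _ (subst (_< k + K) hx xK)) (ℕP.+-cancelˡ-≤ k _ _ (subst (k + K ≤_) hy Ky))

    skewCut-right⁻ : ∀ σ ρ K → SkewCut (skew σ ρ) (k + K) → SkewCut ρ K
    skewCut-right⁻ σ ρ K c j j' jK Kj' = subst₂ _<_ (value-posR σ ρ j') (value-posR σ ρ j)
        (c (posR j) (posR j') (subst (_< k + K) (sym (posR-toℕ j)) (ℕP.+-monoʳ-< k jK))
                            (subst (k + K ≤_) (sym (posR-toℕ j')) (ℕP.+-monoʳ-≤ k Kj')))

    ascent-left⁺ : ∀ σ ρ a b → AscentIn σ a b → AscentIn (skew σ ρ) a b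
    ascent-left⁺ σ ρ a b (i , i' , ai , ii' , i'b , vii') =
      posL i , posL i' , subst (a ≤_) (sym (posL-toℕ i)) ai , subst₂ _<_ (sym (posL-toℕ i)) (sym (posL-toℕ i')) ii' ,
      subst (_< b) (sym (posL-toℕ i')) i'b , subst₂ _<_ (sym (value-posL σ ρ i)) (sym (value-posL σ ρ i')) (ℕP.+-monoˡ-< m vii')

    ascent-right⁺ : ∀ σ ρ a b → AscentIn ρ a b → AscentIn (skew σ ρ) (k + a) (k + b)
    ascent-right⁺ σ ρ a b (j , j' , aj , jj' , j'b , vjj') =
      posR j , posR j' , subst (k + a ≤_) (sym (posR-toℕ j)) (ℕP.+-monoʳ-≤ k aj) ,
      subst₂ _<_ (sym (posR-toℕ j)) (sym (posR-toℕ j')) (ℕP.+-monoʳ-< k jj') ,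
      subst (_< k + b) (sym (posR-toℕ j')) (ℕP.+-monoʳ-< k j'b) ,
      subst₂ _<_ (sym (value-posR σ ρ j)) (sym (value-posR σ ρ j')) vjj'

    ascent⁻ : ∀ σ ρ a b → AscentIn (skew σ ρ) a b → AscentIn σ a b ⊎ AscentIn ρ (a ∸ k) (b ∸ k)
    ascent⁻ σ ρ a b (x , y , ax , xy , yb , vxy) with position-split x | position-split y
    ... | inj₁ (i , hx) | inj₁ (i' , hy) = inj₁ (i , i' , subst (a ≤_) hx ax , subst₂ _<_ hx hy xy ,
          subst (_< b) hy yb , ℕP.+-cancelʳ-< _ _ _ (subst₂ _<_ (value-left σ ρ x i hx) (value-left σ ρ y i' hy) vxy))
    ... | inj₁ (i , hx) | inj₂ (j' , hy) = ⊥-elim (ℕP.<-asym vxy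
          (skewCut-middle σ ρ x y (subst (_< k) (sym hx) (ltk i)) (subst (k ≤_) (sym hy) (gek j'))))
    ... | inj₂ (j , hx) | inj₁ (i' , hy) = ⊥-elim (ℕP.<-asym xy
          (ℕP.<-≤-trans (subst (_< k) (sym hy) (ltk i')) (subst (k ≤_) (sym hx) (gek j))))
    ... | inj₂ (j , hx) | inj₂ (j' , hy) = inj₂ (j , j' ,
          subst (a ∸ k ≤_) (ℕP.m+n∸m≡n k (toℕ j)) (ℕP.∸-monoˡ-≤ k (subst (a ≤_) hx ax)) ,
          ℕP.+-cancelˡ-< k _ _ (subst₂ _<_ hx hy xy) ,
          subst (_< b ∸ k) (ℕP.m+n∸m≡n k (toℕ j')) (ℕP.∸-monoˡ-< (subst (_< b) hy yb) (gek j')) ,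
          subst₂ _<_ (value-right σ ρ x j hx) (value-right σ ρ y j' hy) vxy)

    module Split {π : Word N} (P : IsPerm π) (c : SkewCut π k) where

      -- The m entries on the right take m distinct values below every left entry,
      -- and the k left entries take k distinct values above every right entry.
      left-above-m : ∀ x → toℕ x < k → m ≤ value π x
      left-above-m x xk = injection-bound (λ j → value π (posR j))
        (λ j → c x (posR j) xk (subst (k ≤_) (sym (posR-toℕ j)) (gek j)))
        (λ j j' eq → FinP.toℕ-injective (ℕP.+-cancelˡ-≡ k _ _
           (trans (sym (posR-toℕ j)) (trans (cong toℕ (value-injective {π = π} P _ _ eq)) (posR-toℕ j')))))

      right-below-m : ∀ y → k ≤ toℕ y → value π y < m
      right-below-m y ky = ℕP.+-cancelˡ-≤ k (suc t) m
          (ℕP.≤-trans (ℕP.+-monoˡ-≤ (suc t) kle) (ℕP.≤-reflexive (trans (ℕP.m∸n+n≡m tN) (sym e))))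
        where
        t = value π y
        tN : suc t ≤ N
        tN = FinP.toℕ<n (lookup π y)
        big : ∀ i → suc t ≤ value π (posL i)
        big i = c (posL i) y (subst (_< k) (sym (posL-toℕ i)) (ltk i)) ky
        kle : k ≤ N ∸ suc t
        kle = injection-bound (λ i → value π (posL i) ∸ suc t)
          (λ i → ℕP.∸-monoˡ-< (FinP.toℕ<n (lookup π (posL i))) (big i))
          (λ i i' eq → FinP.toℕ-injective (trans (sym (posL-toℕ i))
              (trans (cong toℕ (value-injective {π = π} P _ _ (ℕP.∸-cancelʳ-≡ (big i) (big i') eq))) (posL-toℕ i'))))

      σ-bound : ∀ i → value π (posL i) ∸ m < k
      σ-bound i = subst (value π (posL i) ∸ m <_) (ℕP.m+n∸n≡m k m)
        (ℕP.∸-monoˡ-< (subst (value π (posL i) <_) (sym e) (FinP.toℕ<n (lookup π (posL i))))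
                      (left-above-m (posL i) (subst (_< k) (sym (posL-toℕ i)) (ltk i))))

      ρ-bound : ∀ j → value π (posR j) < m
      ρ-bound j = right-below-m (posR j) (subst (k ≤_) (sym (posR-toℕ j)) (gek j))

      σ : Word k
      σ = tabulate (λ i → fromℕ< (σ-bound i))

      ρ : Word m
      ρ = tabulate (λ j → fromℕ< (ρ-bound j))

      value-σ : ∀ i → value σ i ≡ value π (posL i) ∸ m
      value-σ i = trans (cong toℕ (VecP.lookup∘tabulate _ i)) (FinP.toℕ-fromℕ< (σ-bound i))

      value-ρ : ∀ j → value ρ j ≡ value π (posR j)
      value-ρ j = trans (cong toℕ (VecP.lookup∘tabulate _ j)) (FinP.toℕ-fromℕ< (ρ-bound j))

      σ-perm : IsPerm σ
      σ-perm i i' eq = FinP.toℕ-injective (trans (sym (posL-toℕ i))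
        (trans (cong toℕ (value-injective {π = π} P _ _ (ℕP.∸-cancelʳ-≡ (lb i) (lb i')
           (trans (sym (value-σ i)) (trans (cong toℕ eq) (value-σ i')))))) (posL-toℕ i')))
        where
        lb : ∀ i → m ≤ value π (posL i)
        lb i = left-above-m (posL i) (subst (_< k) (sym (posL-toℕ i)) (ltk i))

      ρ-perm : IsPerm ρ
      ρ-perm j j' eq = FinP.toℕ-injective (ℕP.+-cancelˡ-≡ k _ _
           (trans (sym (posR-toℕ j)) (trans (cong toℕ (value-injective {π = π} P _ _
              (trans (sym (value-ρ j)) (trans (cong toℕ eq) (value-ρ j'))))) (posR-toℕ j'))))

      π≡skew : π ≡ skew σ ρ
      π≡skew = word-ext λ x → go x (position-split x)
        where
        go : ∀ x → _ → value π x ≡ value (skew σ ρ) x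
        go x (inj₁ (i , hx)) = sym (trans (value-left σ ρ x i hx) (trans (cong (_+ m) (value-σ i))
          (trans (ℕP.m∸n+n≡m (left-above-m (posL i) (subst (_< k) (sym (posL-toℕ i)) (ltk i))))
                 (cong (value π) (FinP.toℕ-injective (trans (posL-toℕ i) (sym hx)))))))
        go x (inj₂ (j , hx)) = sym (trans (value-right σ ρ x j hx) (trans (value-ρ j)
                 (cong (value π) (FinP.toℕ-injective (trans (posR-toℕ j) (sym hx))))))

    split : ∀ {π : Word N} → IsPerm π → SkewCut π k →
            Σ (Word k) λ σ → Σ (Word m) λ ρ → IsPerm σ × IsPerm ρ × (π ≡ skew σ ρ)
    split {π} P c = σ , ρ , σ-perm , ρ-perm , π≡skew
      where open Split {π} P c

module Blocks where

  open Basics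
  open import Data.Nat using (ℕ; suc; _+_; _∸_; _≤_; _<_; z≤n; s≤s)
  import Data.Nat.Properties as ℕP
  open import Data.Fin as Fin using (Fin; toℕ; fromℕ<; inject≤)
  import Data.Fin.Properties as FinP
  open import Data.Vec using (lookup; tabulate)
  import Data.Vec.Properties as VecP
  open import Data.Product using (Σ; _×_; _,_)
  open import Data.Empty using (⊥-elim)
  open import Relation.Nullary using (¬_; Dec)
  open import Relation.Nullary.Decidable using (map′; ¬?; _→-dec_; decidable-stable)
  open import Relation.Binary.PropositionalEquality

  Indecomposable : ∀ {k} → Word k → Set
  Indecomposable {k} σ = ∀ K → 0 < K → K < k → ¬ SkewCut σ K

  indecomposable? : ∀ {k} (σ : Word k) → Dec (Indecomposable σ)
  indecomposable? {k} σ = map′ from-Fin to-Fin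
    (FinP.all? λ K → (0 ℕP.<? toℕ K) →-dec ¬? (skewCut? σ (toℕ K)))
    where
    from-Fin : (∀ (K : Fin k) → 0 < toℕ K → ¬ SkewCut σ (toℕ K)) → Indecomposable σ
    from-Fin h K 0<K K<k cut = h (fromℕ< K<k) (subst (0 <_) (sym (FinP.toℕ-fromℕ< K<k)) 0<K)
                                 (subst (SkewCut σ) (sym (FinP.toℕ-fromℕ< K<k)) cut)
    to-Fin : Indecomposable σ → ∀ (K : Fin k) → 0 < toℕ K → ¬ SkewCut σ (toℕ K)
    to-Fin h K 0<K = h (toℕ K) 0<K (FinP.toℕ<n K)

  -- The first block of a nonempty permutation: the least K ≥ 1 at which it is
  -- cut (K = its length when it is indecomposable).
  first-cut : ∀ {N} (π : Word (suc N)) → Σ ℕ λ K →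
    (1 ≤ K) × (K ≤ suc N) × SkewCut π K × (∀ K′ → 1 ≤ K′ → K′ < K → ¬ SkewCut π K′)
  first-cut {N} π
    with FinP.¬∀⟶∃¬-smallest (suc N) (λ i → ¬ SkewCut π (suc (toℕ i)))
           (λ i → ¬? (skewCut? π _)) (λ no-cut → no-cut (Fin.fromℕ N) cut-at-end)
    where
    cut-at-end : SkewCut π (suc (toℕ (Fin.fromℕ N)))
    cut-at-end x y _ end≤y = ⊥-elim (ℕP.<⇒≱ (FinP.toℕ<n y)
                               (subst (λ t → suc t ≤ toℕ y) (FinP.toℕ-fromℕ N) end≤y))
  ... | i , cut , earlier = suc (toℕ i) , s≤s z≤n , FinP.toℕ<n i ,
        decidable-stable (skewCut? π _) cut , no-earlier
    where
    no-earlier : ∀ K′ → 1 ≤ K′ → K′ < suc (toℕ i) → ¬ SkewCut π K′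
    no-earlier (suc k′) _ (s≤s k′<i) = subst (λ t → ¬ SkewCut π (suc t))
      (trans (FinP.toℕ-inject (fromℕ< k′<i)) (FinP.toℕ-fromℕ< k′<i)) (earlier (fromℕ< k′<i))

  decreasing : ∀ m → Word m
  decreasing m = tabulate Fin.opposite

  value-decreasing : ∀ {m} x → value (decreasing m) x ≡ m ∸ suc (toℕ x)
  value-decreasing {m} x = trans (cong toℕ (VecP.lookup∘tabulate Fin.opposite x)) (FinP.opposite-prop x)

  decreasing-perm : ∀ {m} → IsPerm (decreasing m)
  decreasing-perm x y e = trans (sym (FinP.opposite-involutive x))
    (trans (cong Fin.opposite (trans (sym (VecP.lookup∘tabulate Fin.opposite x))
                               (trans e (VecP.lookup∘tabulate Fin.opposite y))))
      (FinP.opposite-involutive y))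

  decreasing-no-ascent : ∀ {m} a b → ¬ AscentIn (decreasing m) a b
  decreasing-no-ascent {m} a b (x , y , _ , x<y , _ , πx<πy) =
    ℕP.<-asym πx<πy (subst₂ _<_ (sym (value-decreasing y)) (sym (value-decreasing x))
                       (ℕP.∸-monoʳ-< (s≤s x<y) (FinP.toℕ<n y)))

  module _ {m : ℕ} {ρ : Word m} (perm : IsPerm ρ) (no-ascent : ¬ AscentIn ρ 0 m) where

    private
      descending : ∀ x y → toℕ x < toℕ y → value ρ y < value ρ x
      descending x y x<y = ℕP.≤∧≢⇒< (ℕP.≮⇒≥ λ ρx<ρy → no-ascent (x , y , z≤n , x<y , FinP.toℕ<n y , ρx<ρy))
                             (distinct-values {π = ρ} perm y x λ e → ℕP.<-irrefl (sym e) x<y)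

    no-ascent⇒cut-at-1 : SkewCut ρ 1
    no-ascent⇒cut-at-1 x y x<1 1≤y = descending x y (ℕP.<-≤-trans x<1 1≤y)

    -- The m ∸ (x + 1) entries after x have distinct values below ρ(x).
    later-below : ∀ x → m ∸ suc (toℕ x) ≤ value ρ x
    later-below x = injection-bound (λ j → value ρ (later j))
      (λ j → descending x (later j) (subst (toℕ x <_) (sym (toℕ-later j)) (s≤s (ℕP.m≤m+n (toℕ x) (toℕ j)))))
      (λ j j′ e → FinP.toℕ-injective (ℕP.+-cancelˡ-≡ (suc (toℕ x)) _ _
        (trans (sym (toℕ-later j)) (trans (cong toℕ (value-injective {π = ρ} perm _ _ e)) (toℕ-later j′)))))
      where
      later-bound : ∀ (j : Fin (m ∸ suc (toℕ x))) → suc (toℕ x) + toℕ j < m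
      later-bound j = subst (suc (toℕ x) + toℕ j <_) (ℕP.m+[n∸m]≡n (FinP.toℕ<n x))
                        (ℕP.+-monoʳ-< (suc (toℕ x)) (FinP.toℕ<n j))
      later : Fin (m ∸ suc (toℕ x)) → Fin m
      later j = fromℕ< (later-bound j)
      toℕ-later : ∀ j → toℕ (later j) ≡ suc (toℕ x) + toℕ j
      toℕ-later j = FinP.toℕ-fromℕ< (later-bound j)

    -- The x entries before x have distinct values above ρ(x).
    earlier-above : ∀ x → value ρ x ≤ m ∸ suc (toℕ x)
    earlier-above x = ℕP.m+n≤o⇒m≤o∸n (value ρ x)
        (subst₂ _≤_ swap (ℕP.m∸n+n≡m ρx<m) (ℕP.+-monoˡ-≤ (suc (value ρ x)) x≤gap))
      where
      swap : toℕ x + suc (value ρ x) ≡ value ρ x + suc (toℕ x)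
      swap = trans (ℕP.+-suc (toℕ x) (value ρ x))
               (trans (cong suc (ℕP.+-comm (toℕ x) (value ρ x))) (sym (ℕP.+-suc (value ρ x) (toℕ x))))
      ρx<m : suc (value ρ x) ≤ m
      ρx<m = FinP.toℕ<n (lookup ρ x)
      earlier : Fin (toℕ x) → Fin m
      earlier i = inject≤ i (ℕP.<⇒≤ (FinP.toℕ<n x))
      toℕ-earlier : ∀ i → toℕ (earlier i) ≡ toℕ i
      toℕ-earlier i = FinP.toℕ-inject≤ i _
      above : ∀ i → suc (value ρ x) ≤ value ρ (earlier i)
      above i = descending (earlier i) x (subst (_< toℕ x) (sym (toℕ-earlier i)) (FinP.toℕ<n i))
      x≤gap : toℕ x ≤ m ∸ suc (value ρ x)
      x≤gap = injection-bound (λ i → value ρ (earlier i) ∸ suc (value ρ x))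
        (λ i → ℕP.∸-monoˡ-< (FinP.toℕ<n (lookup ρ (earlier i))) (above i))
        (λ i i′ e → FinP.toℕ-injective (trans (sym (toℕ-earlier i))
          (trans (cong toℕ (value-injective {π = ρ} perm _ _ (ℕP.∸-cancelʳ-≡ (above i) (above i′) e)))
            (toℕ-earlier i′))))

    no-ascent⇒decreasing : ρ ≡ decreasing m
    no-ascent⇒decreasing = word-ext λ x →
      trans (ℕP.≤-antisym (earlier-above x) (later-below x)) (sym (value-decreasing x))

module ListCounting where

  open import Data.Nat using (ℕ; zero; suc; _+_; _*_)
  open import Data.Fin as Fin using (Fin)
  import Data.Fin.Properties as FinP
  open import Data.List using (List; []; _∷_; map; _++_; length; cartesianProductWith)
  open import Data.List.Properties using (length-++; length-map)
  open import Data.List.Membership.Propositional using (_∈_)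
  open import Data.List.Membership.Propositional.Properties using (∈-++⁺ˡ; ∈-++⁺ʳ; ∈-++⁻)
  open import Data.List.Membership.Propositional.Properties.WithK using (unique∧set⇒bag)
  open import Data.List.Relation.Binary.BagAndSetEquality using (∼bag⇒↭)
  open import Data.List.Relation.Binary.Permutation.Propositional.Properties using (↭-length)
  open import Data.List.Relation.Unary.AllPairs using ([])
  open import Data.List.Relation.Unary.Unique.Propositional using (Unique)
  import Data.List.Relation.Unary.Unique.Propositional.Properties as Unique
  open import Data.Product using (Σ; _,_)
  open import Data.Sum using (inj₁; inj₂)
  open import Data.Empty using (⊥)
  open import Relation.Binary.PropositionalEquality
  open import Function using (_∘_)
  open import Function.Bundles using (_⇔_)

  unique-length : ∀ {A : Set} {xs ys : List A} → Unique xs → Unique ys →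
                  (∀ {z} → z ∈ xs ⇔ z ∈ ys) → length xs ≡ length ys
  unique-length xs! ys! same = ↭-length (∼bag⇒↭ (unique∧set⇒bag xs! ys! same))

  length-cartesianProductWith : ∀ {A B C : Set} (f : A → B → C) xs ys →
    length (cartesianProductWith f xs ys) ≡ length xs * length ys
  length-cartesianProductWith f [] ys = refl
  length-cartesianProductWith f (x ∷ xs) ys = trans (length-++ (map (f x) ys))
    (cong₂ _+_ (length-map (f x) ys) (length-cartesianProductWith f xs ys))

  sumFin : ∀ n → (Fin n → ℕ) → ℕ
  sumFin zero h = 0
  sumFin (suc n) h = h Fin.zero + sumFin n (h ∘ Fin.suc)

  sumFin-cong : ∀ n {g h : Fin n → ℕ} → (∀ j → g j ≡ h j) → sumFin n g ≡ sumFin n h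
  sumFin-cong zero e = refl
  sumFin-cong (suc n) e = cong₂ _+_ (e Fin.zero) (sumFin-cong n (e ∘ Fin.suc))

  sumFin-const : ∀ n c → sumFin n (λ _ → c) ≡ n * c
  sumFin-const zero c = refl
  sumFin-const (suc n) c = cong (c +_) (sumFin-const n c)

  module _ {A : Set} where

    concatFin : ∀ n → (Fin n → List A) → List A
    concatFin zero g = []
    concatFin (suc n) g = g Fin.zero ++ concatFin n (g ∘ Fin.suc)

    length-concatFin : ∀ n (g : Fin n → List A) → length (concatFin n g) ≡ sumFin n (length ∘ g)
    length-concatFin zero g = refl
    length-concatFin (suc n) g =
      trans (length-++ (g Fin.zero)) (cong (length (g Fin.zero) +_) (length-concatFin n (g ∘ Fin.suc)))

    ∈-concatFin⁺ : ∀ {n} (g : Fin n → List A) j {z} → z ∈ g j → z ∈ concatFin n g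
    ∈-concatFin⁺ {suc n} g Fin.zero z∈ = ∈-++⁺ˡ z∈
    ∈-concatFin⁺ {suc n} g (Fin.suc j) z∈ = ∈-++⁺ʳ (g Fin.zero) (∈-concatFin⁺ (g ∘ Fin.suc) j z∈)

    ∈-concatFin⁻ : ∀ {n} (g : Fin n → List A) {z} → z ∈ concatFin n g → Σ (Fin n) λ j → z ∈ g j
    ∈-concatFin⁻ {suc n} g z∈ with ∈-++⁻ (g Fin.zero) z∈
    ... | inj₁ z∈g0 = Fin.zero , z∈g0
    ... | inj₂ z∈rest with ∈-concatFin⁻ (g ∘ Fin.suc) z∈rest
    ...   | j , z∈gj = Fin.suc j , z∈gj

    concatFin-unique : ∀ {n} (g : Fin n → List A) → (∀ j → Unique (g j)) →
      (∀ j j′ {z} → z ∈ g j → z ∈ g j′ → j ≡ j′) → Unique (concatFin n g)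
    concatFin-unique {zero} g g! disjoint = []
    concatFin-unique {suc n} g g! disjoint = Unique.++⁺ (g! Fin.zero)
      (concatFin-unique (g ∘ Fin.suc) (g! ∘ Fin.suc)
        λ j j′ z∈ z∈′ → FinP.suc-injective (disjoint (Fin.suc j) (Fin.suc j′) z∈ z∈′))
      λ (z∈g0 , z∈rest) → 0≢suc (∈-concatFin⁻ (g ∘ Fin.suc) z∈rest) z∈g0
      where
      0≢suc : ∀ {z} → (Σ (Fin n) λ j → z ∈ g (Fin.suc j)) → z ∈ g Fin.zero → ⊥
      0≢suc (j , z∈gj) z∈g0 with () ← disjoint Fin.zero (Fin.suc j) z∈g0 z∈gj

module Permutations where

  open Basics using (vec-ext)
  open ListCounting
  open import Data.Nat using (zero; suc; _!)
  open import Data.Fin as Fin using (Fin; punchIn; punchOut)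
  import Data.Fin.Properties as FinP
  open import Data.Vec as Vec using (Vec; lookup; tabulate; _∷_; [])
  import Data.Vec.Properties as VecP
  open import Data.List using (List; map; length) renaming (_∷_ to _∷ₗ_; [] to []ₗ)
  open import Data.List.Properties using (length-map)
  open import Data.List.Membership.Propositional using (_∈_)
  open import Data.List.Membership.Propositional.Properties using (∈-map⁺; ∈-map⁻)
  open import Data.List.Relation.Unary.Any using (here)
  open import Data.List.Relation.Unary.All using () renaming ([] to []ᴬ)
  open import Data.List.Relation.Unary.AllPairs using () renaming ([] to []ᴾ; _∷_ to _∷ᴾ_)
  open import Data.List.Relation.Unary.Unique.Propositional using (Unique)
  import Data.List.Relation.Unary.Unique.Propositional.Properties as Unique
  open import Data.Product using (∃; _×_; _,_)
  open import Data.Empty using (⊥-elim)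
  open import Relation.Binary.PropositionalEquality

  -- The permutation with first value a whose remaining values, with a removed,
  -- follow π.
  insert-first : ∀ {n} → Fin (suc n) → Word n → Word (suc n)
  insert-first a π = a ∷ Vec.map (punchIn a) π

  private
    lookup-insert : ∀ {n} a (π : Word n) i → lookup (insert-first a π) (Fin.suc i) ≡ punchIn a (lookup π i)
    lookup-insert a π i = VecP.lookup-map i (punchIn a) π

  insert-first-injective : ∀ {n} a {π π′ : Word n} → insert-first a π ≡ insert-first a π′ → π ≡ π′
  insert-first-injective a {π} {π′} e = vec-ext λ i → FinP.punchIn-injective a _ _
    (trans (sym (lookup-insert a π i)) (trans (cong (λ w → lookup w (Fin.suc i)) e) (lookup-insert a π′ i)))

  insert-first-perm : ∀ {n} a {π : Word n} → IsPerm π → IsPerm (insert-first a π)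
  insert-first-perm a {π} perm Fin.zero Fin.zero e = refl
  insert-first-perm a {π} perm Fin.zero (Fin.suc j) e =
    ⊥-elim (FinP.punchInᵢ≢i a (lookup π j) (trans (sym (lookup-insert a π j)) (sym e)))
  insert-first-perm a {π} perm (Fin.suc i) Fin.zero e =
    ⊥-elim (FinP.punchInᵢ≢i a (lookup π i) (trans (sym (lookup-insert a π i)) e))
  insert-first-perm a {π} perm (Fin.suc i) (Fin.suc j) e = cong Fin.suc (perm i j
    (FinP.punchIn-injective a _ _ (trans (sym (lookup-insert a π i)) (trans e (lookup-insert a π j)))))

  permutations : ∀ n → List (Word n)
  starting-with : ∀ n → Fin (suc n) → List (Word (suc n))
  permutations zero = [] ∷ₗ []ₗ
  permutations (suc n) = concatFin (suc n) (starting-with n)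
  starting-with n a = map (insert-first a) (permutations n)

  length-permutations : ∀ n → length (permutations n) ≡ n !
  length-permutations zero = refl
  length-permutations (suc n) = trans (length-concatFin (suc n) (starting-with n))
    (trans (sumFin-cong (suc n) λ a → trans (length-map (insert-first a) (permutations n)) (length-permutations n))
           (sumFin-const (suc n) (n !)))

  permutations-unique : ∀ n → Unique (permutations n)
  permutations-unique zero = []ᴬ ∷ᴾ []ᴾ
  permutations-unique (suc n) =
    concatFin-unique (starting-with n) (λ a → Unique.map⁺ (insert-first-injective a) (permutations-unique n))
      λ a a′ z∈ z∈′ → same-first (∈-map⁻ (insert-first a) z∈) (∈-map⁻ (insert-first a′) z∈′)
    where
    same-first : ∀ {a a′ z} → (∃ λ π → π ∈ permutations n × z ≡ insert-first a π) →
                 (∃ λ π → π ∈ permutations n × z ≡ insert-first a′ π) → a ≡ a′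
    same-first (π , _ , refl) (π′ , _ , e) = VecP.∷-injectiveˡ e

  permutations-perm : ∀ {n} {π : Word n} → π ∈ permutations n → IsPerm π
  permutations-perm {zero} {[]} _ ()
  permutations-perm {suc n} π∈ with ∈-concatFin⁻ (starting-with n) π∈
  ... | a , π∈a with ∈-map⁻ (insert-first a) π∈a
  ...   | π′ , π′∈ , refl = insert-first-perm a (permutations-perm π′∈)

  permutations-complete : ∀ {n} {π : Word n} → IsPerm π → π ∈ permutations n
  permutations-complete {zero} {[]} _ = here refl
  permutations-complete {suc n} {a ∷ rest} perm =
    ∈-concatFin⁺ (starting-with n) a
      (subst (_∈ starting-with n a) (sym π≡) (∈-map⁺ (insert-first a) (permutations-complete π′-perm)))
    where
    a≢ : ∀ i → a ≢ lookup rest i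
    a≢ i e with () ← perm Fin.zero (Fin.suc i) e
    π′ : Word n
    π′ = tabulate (λ i → punchOut (a≢ i))
    lookup-π′ : ∀ i → lookup π′ i ≡ punchOut (a≢ i)
    lookup-π′ = VecP.lookup∘tabulate _
    π′-perm : IsPerm π′
    π′-perm i j e = FinP.suc-injective (perm (Fin.suc i) (Fin.suc j)
      (FinP.punchOut-injective (a≢ i) (a≢ j) (trans (sym (lookup-π′ i)) (trans e (lookup-π′ j)))))
    π≡ : a ∷ rest ≡ insert-first a π′
    π≡ = cong (a ∷_) (vec-ext λ i → sym (trans (VecP.lookup-map i (punchIn a) π′)
           (trans (cong (punchIn a) (lookup-π′ i)) (FinP.punchIn-punchOut (a≢ i)))))

module Indecomposables where

  open Basics
  open SkewSums
  open Blocks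
  open ListCounting
  open Permutations
  open import Data.Nat using (ℕ; suc; _+_; _∸_; _*_; _!; _≤_; _<_; s≤s)
  import Data.Nat.Properties as ℕP
  open import Data.Fin using (Fin; toℕ; fromℕ<)
  import Data.Fin.Properties as FinP
  open import Data.List using (List; filter; length; _++_; cartesianProductWith)
  open import Data.List.Properties using (length-++)
  open import Data.List.Membership.Propositional using (_∈_)
  open import Data.List.Membership.Propositional.Properties
    using (∈-filter⁺; ∈-filter⁻; ∈-++⁺ˡ; ∈-++⁺ʳ; ∈-++⁻; ∈-cartesianProductWith⁺; ∈-cartesianProductWith⁻)
  open import Data.List.Relation.Unary.Unique.Propositional using (Unique)
  import Data.List.Relation.Unary.Unique.Propositional.Properties as Unique
  open import Data.Product using (Σ; _×_; _,_; proj₁; proj₂)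
  open import Data.Sum using (inj₁; inj₂)
  open import Data.Empty using (⊥; ⊥-elim)
  open import Relation.Nullary using (¬_; yes; no)
  open import Relation.Binary.PropositionalEquality
  open import Relation.Binary.Definitions using (tri<; tri≈; tri>)
  open import Function.Bundles using (mk⇔)

  indecomposables : ∀ n → List (Word n)
  indecomposables n = filter indecomposable? (permutations n)

  indecCount : ℕ → ℕ
  indecCount n = length (indecomposables n)

  ∈-indecomposables⁺ : ∀ {n} {σ : Word n} → IsPerm σ → Indecomposable σ → σ ∈ indecomposables n
  ∈-indecomposables⁺ perm indec = ∈-filter⁺ indecomposable? (permutations-complete perm) indec

  ∈-indecomposables⁻ : ∀ {n} {σ : Word n} → σ ∈ indecomposables n → IsPerm σ × Indecomposable σ
  ∈-indecomposables⁻ σ∈ with ∈-filter⁻ indecomposable? σ∈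
  ... | σ∈perms , indec = permutations-perm σ∈perms , indec

  indecomposables-unique : ∀ n → Unique (indecomposables n)
  indecomposables-unique n = Unique.filter⁺ indecomposable? (permutations-unique n)

  first-block-size-unique : ∀ {k m k′ m′ N} (e : k + m ≡ N) (e′ : k′ + m′ ≡ N) {σ ρ σ′ ρ′} →
    Indecomposable σ → Indecomposable σ′ → 0 < k → 0 < k′ →
    SkewSum.skew e σ ρ ≡ SkewSum.skew e′ σ′ ρ′ → k ≡ k′
  first-block-size-unique {k} {m} {k′} e e′ {σ} {ρ} {σ′} {ρ′} indec indec′ 0<k 0<k′ same
    with ℕP.<-cmp k k′
  ... | tri≈ _ k≡k′ _ = k≡k′
  ... | tri< k<k′ _ _ = ⊥-elim (indec′ k 0<k k<k′ (SkewSum.skewCut-left⁻ e′ σ′ ρ′ k (ℕP.<⇒≤ k<k′)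
          (subst (λ w → SkewCut w k) same (SkewSum.skewCut-middle e σ ρ))))
  ... | tri> _ _ k>k′ = ⊥-elim (indec k′ 0<k′ k>k′ (SkewSum.skewCut-left⁻ e σ ρ k′ (ℕP.<⇒≤ k>k′)
          (subst (λ w → SkewCut w k′) (sym same) (SkewSum.skewCut-middle e′ σ′ ρ′))))

  first-block-indecomposable : ∀ {k m N} (e : k + m ≡ N) {π : Word N} {σ ρ} → π ≡ SkewSum.skew e σ ρ →
    (∀ K → 1 ≤ K → K < k → ¬ SkewCut π K) → Indecomposable σ
  first-block-indecomposable {k} e {π} {σ} {ρ} π≡ no-earlier K 0<K K<k cut =
    no-earlier K 0<K K<k (subst (λ w → SkewCut w K) (sym π≡) (SkewSum.skewCut-left⁺ e σ ρ K (ℕP.<⇒≤ K<k) cut))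

  -- Permutations of length n + 1 by their first block: either indecomposable,
  -- or σ ⊖ ρ with σ indecomposable of length n ∸ j and ρ arbitrary of length j + 1.
  module FirstBlock (n : ℕ) where

    sizes : ∀ (j : Fin n) → (n ∸ toℕ j) + suc (toℕ j) ≡ suc n
    sizes j = trans (ℕP.+-suc (n ∸ toℕ j) (toℕ j)) (cong suc (ℕP.m∸n+n≡m (ℕP.<⇒≤ (FinP.toℕ<n j))))

    glue : ∀ (j : Fin n) → Word (n ∸ toℕ j) → Word (suc (toℕ j)) → Word (suc n)
    glue j = SkewSum.skew (sizes j)

    0<size : ∀ (j : Fin n) → 0 < n ∸ toℕ j
    0<size j = ℕP.m<n⇒0<n∸m (FinP.toℕ<n j)

    decomposable : Fin n → List (Word (suc n))
    decomposable j = cartesianProductWith (glue j) (indecomposables (n ∸ toℕ j)) (permutations (suc (toℕ j)))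

    by-first-block : List (Word (suc n))
    by-first-block = indecomposables (suc n) ++ concatFin n decomposable

    private
      ∈-decomposable⁻ : ∀ j {π} → π ∈ decomposable j → Σ _ λ σ → Σ _ λ ρ →
        σ ∈ indecomposables (n ∸ toℕ j) × ρ ∈ permutations (suc (toℕ j)) × π ≡ glue j σ ρ
      ∈-decomposable⁻ j = ∈-cartesianProductWith⁻ (glue j) (indecomposables _) (permutations _)

    by-first-block-perm : ∀ {π} → π ∈ by-first-block → IsPerm π
    by-first-block-perm π∈ with ∈-++⁻ (indecomposables (suc n)) π∈
    ... | inj₁ π∈ind = proj₁ (∈-indecomposables⁻ π∈ind)
    ... | inj₂ π∈dec with ∈-concatFin⁻ decomposable π∈dec
    ...   | j , π∈j with ∈-decomposable⁻ j π∈j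
    ...     | σ , ρ , σ∈ , ρ∈ , refl =
              SkewSum.skew-perm (sizes j) (proj₁ (∈-indecomposables⁻ σ∈)) (permutations-perm ρ∈)

    -- A permutation whose first cut K is before its end is glued at j = n ∸ K.
    by-first-block-complete : ∀ {π} → IsPerm π → π ∈ by-first-block
    by-first-block-complete {π} perm with first-cut π
    ... | K , 1≤K , K≤n+1 , cut , no-earlier with K ℕP.≟ suc n
    ...   | yes refl = ∈-++⁺ˡ (∈-indecomposables⁺ perm no-earlier)
    ...   | no K≢n+1 = ∈-++⁺ʳ (indecomposables (suc n)) (∈-concatFin⁺ decomposable j
              (subst (_∈ decomposable j) (sym π≡)
                (∈-cartesianProductWith⁺ (glue j) (∈-indecomposables⁺ σ-perm σ-indec) (permutations-complete ρ-perm))))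
      where
      K≤n : K ≤ n
      K≤n = ℕP.≤-pred (ℕP.≤∧≢⇒< K≤n+1 K≢n+1)
      j<n : n ∸ K < n
      j<n = ℕP.∸-monoʳ-< {n} {K} {0} 1≤K K≤n
      j : Fin n
      j = fromℕ< j<n
      size≡K : n ∸ toℕ j ≡ K
      size≡K = trans (cong (n ∸_) (FinP.toℕ-fromℕ< j<n)) (ℕP.m∸[m∸n]≡n K≤n)
      parts = SkewSum.split (sizes j) perm (subst (SkewCut π) (sym size≡K) cut)
      σ = proj₁ parts
      ρ = proj₁ (proj₂ parts)
      σ-perm = proj₁ (proj₂ (proj₂ parts))
      ρ-perm = proj₁ (proj₂ (proj₂ (proj₂ parts)))
      π≡ : π ≡ glue j σ ρ
      π≡ = proj₂ (proj₂ (proj₂ (proj₂ parts)))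
      σ-indec : Indecomposable σ
      σ-indec = first-block-indecomposable (sizes j) π≡ λ K′ 1≤K′ K′<size → no-earlier K′ 1≤K′ (subst (K′ <_) size≡K K′<size)

    -- The decomposition is unique: the first block has a unique size, an
    -- indecomposable permutation is not a proper skew sum, and skew sums are injective.
    by-first-block-unique : Unique by-first-block
    by-first-block-unique = Unique.++⁺ (indecomposables-unique (suc n))
      (concatFin-unique decomposable
        (λ j → Unique.cartesianProductWith⁺ (glue j) (SkewSum.skew-inj (sizes j))
                 (indecomposables-unique _) (permutations-unique _))
        λ j j′ π∈ π∈′ → same-size j j′ (∈-decomposable⁻ j π∈) (∈-decomposable⁻ j′ π∈′))
      λ (π∈ind , π∈dec) → not-both (∈-indecomposables⁻ π∈ind) (∈-concatFin⁻ decomposable π∈dec)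
      where
      same-size : ∀ j j′ {π} → (Σ _ λ σ → Σ _ λ ρ → σ ∈ indecomposables _ × ρ ∈ permutations _ × π ≡ glue j σ ρ) →
                  (Σ _ λ σ → Σ _ λ ρ → σ ∈ indecomposables _ × ρ ∈ permutations _ × π ≡ glue j′ σ ρ) → j ≡ j′
      same-size j j′ (σ , ρ , σ∈ , _ , refl) (σ′ , ρ′ , σ′∈ , _ , same) =
        FinP.toℕ-injective (ℕP.∸-cancelˡ-≡ (ℕP.<⇒≤ (FinP.toℕ<n j)) (ℕP.<⇒≤ (FinP.toℕ<n j′))
          (first-block-size-unique (sizes j) (sizes j′) (proj₂ (∈-indecomposables⁻ σ∈))
            (proj₂ (∈-indecomposables⁻ σ′∈)) (0<size j) (0<size j′) same))
      not-both : ∀ {π} → IsPerm π × Indecomposable π → (Σ (Fin n) λ j → π ∈ decomposable j) → ⊥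
      not-both (_ , indec) (j , π∈) with ∈-decomposable⁻ j π∈
      ... | σ , ρ , _ , _ , refl = indec (n ∸ toℕ j) (0<size j) (s≤s (ℕP.m∸n≤m n (toℕ j)))
                                     (SkewSum.skewCut-middle (sizes j) σ ρ)

    factorial-decomposition :
      (suc n) ! ≡ indecCount (suc n) + sumFin n (λ j → indecCount (n ∸ toℕ j) * (suc (toℕ j)) !)
    factorial-decomposition = begin
      (suc n) !                          ≡⟨ length-permutations (suc n) ⟨
      length (permutations (suc n))      ≡⟨ unique-length (permutations-unique (suc n)) by-first-block-unique
                                              (mk⇔ (λ π∈ → by-first-block-complete (permutations-perm π∈))
                                                   (λ π∈ → permutations-complete (by-first-block-perm π∈))) ⟩
      length by-first-block              ≡⟨ length-++ (indecomposables (suc n)) ⟩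
      indecCount (suc n) + length (concatFin n decomposable)
        ≡⟨ cong (indecCount (suc n) +_) (trans (length-concatFin n decomposable) (sumFin-cong n λ j →
             trans (length-cartesianProductWith (glue j) (indecomposables _) (permutations _))
                   (cong (indecCount (n ∸ toℕ j) *_) (length-permutations (suc (toℕ j)))))) ⟩
      indecCount (suc n) + sumFin n (λ j → indecCount (n ∸ toℕ j) * (suc (toℕ j)) !) ∎
      where open ≡-Reasoning

module ConnectedPermutations where

  open Basics
  open SkewSums
  open Blocks
  open ListCounting
  open Indecomposables
  open import Data.Nat using (zero; suc; _+_; _∸_; _≤_; _<_; z≤n; s≤s)
  import Data.Nat.Properties as ℕP
  open import Data.Fin as Fin using (Fin; toℕ; fromℕ<)
  import Data.Fin.Properties as FinP
  open import Data.Vec using ([]; _∷_)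
  open import Data.List using (List; map; length; _++_) renaming (_∷_ to _∷ₗ_; [] to []ₗ)
  open import Data.List.Properties using (length-map; length-++)
  open import Data.List.Membership.Propositional using (_∈_)
  open import Data.List.Membership.Propositional.Properties using (∈-map⁺; ∈-map⁻; ∈-++⁺ˡ; ∈-++⁺ʳ; ∈-++⁻)
  open import Data.List.Relation.Unary.Any using (here)
  open import Data.List.Relation.Unary.All using () renaming ([] to []ᴬ)
  open import Data.List.Relation.Unary.AllPairs using () renaming ([] to []ᴾ; _∷_ to _∷ᴾ_)
  open import Data.List.Relation.Unary.Unique.Propositional using (Unique)
  import Data.List.Relation.Unary.Unique.Propositional.Properties as Unique
  open import Data.Product using (Σ; ∃; _×_; _,_; proj₁; proj₂)
  open import Data.Sum using (inj₁; inj₂)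
  open import Data.Empty using (⊥; ⊥-elim)
  open import Relation.Nullary using (¬_; yes; no)
  open import Relation.Binary.PropositionalEquality

  one-then : ∀ {n} → Word n → Word (suc n)
  one-then {n} = SkewSum.skew {1} {n} refl (decreasing 1)

  word-of-length-1 : ∀ (σ : Word 1) → σ ≡ decreasing 1
  word-of-length-1 (Fin.zero ∷ []) = refl

  one-then-noBadCut⁺ : ∀ {n} {ρ : Word n} → NoBadCut ρ → NoBadCut (one-then ρ)
  one-then-noBadCut⁺ {n} {ρ} ok K (cut , left@(_ , _ , _ , x<y , y<K , _) , right) = ok (K ∸ 1) (cut′ , left′ left , right′ right)
    where
    open SkewSum {1} {n} refl
    1≤K : 1 ≤ K
    1≤K = ℕP.≤-<-trans z≤n (ℕP.<-trans x<y y<K)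
    cut′ : SkewCut ρ (K ∸ 1)
    cut′ = skewCut-right⁻ (decreasing 1) ρ (K ∸ 1) (subst (SkewCut (one-then ρ)) (sym (ℕP.m+[n∸m]≡n 1≤K)) cut)
    left′ : AscentIn (one-then ρ) 0 K → AscentIn ρ 0 (K ∸ 1)
    left′ a with ascent⁻ (decreasing 1) ρ 0 K a
    ... | inj₁ a₁ = ⊥-elim (decreasing-no-ascent 0 K a₁)
    ... | inj₂ aρ = aρ
    right′ : AscentIn (one-then ρ) K (suc n) → AscentIn ρ (K ∸ 1) n
    right′ a with ascent⁻ (decreasing 1) ρ K (suc n) a
    ... | inj₁ a₁ = ⊥-elim (decreasing-no-ascent K (suc n) a₁)
    ... | inj₂ aρ = aρ

  one-then-noBadCut⁻ : ∀ {n} {ρ : Word n} → NoBadCut (one-then ρ) → NoBadCut ρ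
  one-then-noBadCut⁻ {n} {ρ} ok K (cut , left , right) =
    ok (suc K) ( skewCut-right⁺ (decreasing 1) ρ K cut
               , weaken (ascent-right⁺ (decreasing 1) ρ 0 K left)
               , ascent-right⁺ (decreasing 1) ρ K n right)
    where
    open SkewSum {1} {n} refl
    weaken : AscentIn (one-then ρ) 1 (suc K) → AscentIn (one-then ρ) 0 (suc K)
    weaken (x , y , _ , rest) = x , y , z≤n , rest

  -- An indecomposable permutation of length at least 2 has an ascent
  -- (otherwise it would be cut after its first entry).
  indecomposable-ascent : ∀ {k} {σ : Word k} → IsPerm σ → Indecomposable σ → 2 ≤ k → AscentIn σ 0 k
  indecomposable-ascent {k} {σ} perm indec 2≤k with ascentIn? σ 0 k
  ... | yes a = a
  ... | no none = ⊥-elim (indec 1 (s≤s z≤n) 2≤k (no-ascent⇒cut-at-1 {ρ = σ} perm none))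

  -- σ ⊖ δ with σ indecomposable has no bad cut: the only ascents lie in σ,
  -- so a bad cut would be a proper cut of σ.
  indecomposable-then-decreasing : ∀ {k m N} (e : k + m ≡ N) {σ : Word k} → Indecomposable σ →
                                   NoBadCut (SkewSum.skew e σ (decreasing m))
  indecomposable-then-decreasing {k} {m} {N} e {σ} indec K (cut , (_ , _ , _ , x<y , y<K , _) , right)
    with SkewSum.ascent⁻ e σ (decreasing m) K N right
  ... | inj₂ aδ = decreasing-no-ascent _ _ aδ
  ... | inj₁ (i , _ , K≤i , _) = indec K (ℕP.≤-<-trans z≤n (ℕP.<-trans x<y y<K)) K<k
                                   (SkewSum.skewCut-left⁻ e σ (decreasing m) K (ℕP.<⇒≤ K<k) cut)
    where
    K<k : K < k
    K<k = ℕP.≤-<-trans K≤i (FinP.toℕ<n i)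

  -- The permutations of length n without bad cuts, listed recursively: those
  -- of length n + 1 are 1 ⊖ ρ for ρ of length n, or σ ⊖ δⱼ with σ indecomposable
  -- of length n + 1 − j ≥ 2 and δⱼ decreasing.
  sizes : ∀ {n} (j : Fin n) → (suc n ∸ toℕ j) + toℕ j ≡ suc n
  sizes {n} j = ℕP.m∸n+n≡m (ℕP.<⇒≤ (s≤s (ℕP.<⇒≤ (FinP.toℕ<n j))))

  then-decreasing : ∀ {n} (j : Fin n) → Word (suc n ∸ toℕ j) → Word (suc n)
  then-decreasing j σ = SkewSum.skew (sizes j) σ (decreasing (toℕ j))

  2≤size : ∀ {n} (j : Fin n) → 2 ≤ suc n ∸ toℕ j
  2≤size j = ℕP.m+n≤o⇒m≤o∸n 2 (s≤s (FinP.toℕ<n j))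

  with-block : ∀ n → Fin n → List (Word (suc n))
  with-block n j = map (then-decreasing j) (indecomposables (suc n ∸ toℕ j))

  connected : ∀ n → List (Word n)
  connected zero = [] ∷ₗ []ₗ
  connected (suc n) = map one-then (connected n) ++ concatFin n (with-block n)

  length-connected : ∀ n →
    length (connected (suc n)) ≡ length (connected n) + sumFin n (λ j → indecCount (suc n ∸ toℕ j))
  length-connected n = trans (length-++ (map one-then (connected n)))
    (cong₂ _+_ (length-map one-then (connected n))
      (trans (length-concatFin n (with-block n))
        (sumFin-cong n λ j → length-map (then-decreasing j) (indecomposables (suc n ∸ toℕ j)))))

  connected-sound : ∀ n {π} → π ∈ connected n → IsPerm π × NoBadCut π
  connected-sound zero {[]} _ = (λ ()) , λ { K (_ , (() , _) , _) }
  connected-sound (suc n) π∈ with ∈-++⁻ (map one-then (connected n)) π∈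
  ... | inj₁ π∈one with ∈-map⁻ one-then π∈one
  ...   | ρ , ρ∈ , refl =
          SkewSum.skew-perm refl {decreasing 1} {ρ} decreasing-perm (proj₁ (connected-sound n ρ∈)) ,
          one-then-noBadCut⁺ {ρ = ρ} (proj₂ (connected-sound n ρ∈))
  connected-sound (suc n) π∈ | inj₂ π∈blocks with ∈-concatFin⁻ (with-block n) π∈blocks
  ... | j , π∈j with ∈-map⁻ (then-decreasing j) π∈j
  ...   | σ , σ∈ , refl =
          SkewSum.skew-perm (sizes j) {σ} {decreasing (toℕ j)} (proj₁ (∈-indecomposables⁻ σ∈)) decreasing-perm ,
          indecomposable-then-decreasing (sizes j) (proj₂ (∈-indecomposables⁻ σ∈))

  cut-at-1 : ∀ {n} {π : Word (suc n)} → IsPerm π → SkewCut π 1 → Σ (Word n) λ ρ → IsPerm ρ × π ≡ one-then ρ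
  cut-at-1 {n} {π} perm cut = ρ , ρ-perm , trans π≡ (cong (λ σ → SkewSum.skew refl σ ρ) (word-of-length-1 σ))
    where
    parts = SkewSum.split {1} {n} refl perm cut
    σ = proj₁ parts
    ρ = proj₁ (proj₂ parts)
    ρ-perm = proj₁ (proj₂ (proj₂ (proj₂ parts)))
    π≡ = proj₂ (proj₂ (proj₂ (proj₂ parts)))

  -- A permutation without bad cuts whose first cut K is at least 2 is σ ⊖ δⱼ:
  -- its first block σ is indecomposable of length K ≥ 2, hence has an ascent,
  -- so the rest has none (else K is a bad cut) and is decreasing.
  later-first-cut : ∀ {n} {π : Word (suc n)} → IsPerm π → NoBadCut π → ∀ K → 2 ≤ K → K ≤ suc n → SkewCut π K →
    (∀ K′ → 1 ≤ K′ → K′ < K → ¬ SkewCut π K′) →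
    Σ (Fin n) λ j → Σ (Word (suc n ∸ toℕ j)) λ σ → σ ∈ indecomposables _ × π ≡ then-decreasing j σ
  later-first-cut {n} {π} perm ok K 2≤K K≤n+1 cut no-earlier =
    j , σ , ∈-indecomposables⁺ σ-perm σ-indec , trans π≡ (cong (SkewSum.skew (sizes j) σ) ρ≡)
    where
    j<n : suc n ∸ K < n
    j<n = ℕP.∸-monoʳ-< {suc n} {K} {1} 2≤K K≤n+1
    j : Fin n
    j = fromℕ< j<n
    k = suc n ∸ toℕ j
    k≡K : k ≡ K
    k≡K = trans (cong (suc n ∸_) (FinP.toℕ-fromℕ< j<n)) (ℕP.m∸[m∸n]≡n K≤n+1)
    parts = SkewSum.split (sizes j) perm (subst (SkewCut π) (sym k≡K) cut)
    σ = proj₁ parts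
    ρ = proj₁ (proj₂ parts)
    σ-perm = proj₁ (proj₂ (proj₂ parts))
    ρ-perm = proj₁ (proj₂ (proj₂ (proj₂ parts)))
    π≡ : π ≡ SkewSum.skew (sizes j) σ ρ
    π≡ = proj₂ (proj₂ (proj₂ (proj₂ parts)))
    σ-indec : Indecomposable σ
    σ-indec = first-block-indecomposable (sizes j) π≡ λ K′ 1≤K′ K′<k → no-earlier K′ 1≤K′ (subst (K′ <_) k≡K K′<k)
    ρ-no-ascent : ¬ AscentIn ρ 0 (toℕ j)
    ρ-no-ascent aρ = ok k
      ( subst (λ w → SkewCut w k) (sym π≡) (SkewSum.skewCut-middle (sizes j) σ ρ)
      , subst (λ w → AscentIn w 0 k) (sym π≡)
          (SkewSum.ascent-left⁺ (sizes j) σ ρ 0 k (indecomposable-ascent {σ = σ} σ-perm σ-indec (subst (2 ≤_) (sym k≡K) 2≤K)))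
      , subst₂ (λ w t → AscentIn w k t) (sym π≡) (sizes j)
          (subst (λ t → AscentIn (SkewSum.skew (sizes j) σ ρ) t (k + toℕ j)) (ℕP.+-identityʳ k)
            (SkewSum.ascent-right⁺ (sizes j) σ ρ 0 (toℕ j) aρ)))
    ρ≡ : ρ ≡ decreasing (toℕ j)
    ρ≡ = no-ascent⇒decreasing {ρ = ρ} ρ-perm ρ-no-ascent

  connected-complete : ∀ n {π} → IsPerm π → NoBadCut π → π ∈ connected n
  connected-complete zero {[]} _ _ = here refl
  connected-complete (suc n) {π} perm ok with first-cut π
  ... | K , 1≤K , K≤n+1 , cut , no-earlier with K ℕP.≟ 1
  ...   | yes refl = ∈-++⁺ˡ (subst (_∈ map one-then (connected n)) (sym π≡)
                       (∈-map⁺ one-then (connected-complete n {ρ} ρ-perm (one-then-noBadCut⁻ {ρ = ρ} (subst NoBadCut π≡ ok)))))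
    where
    ρ = proj₁ (cut-at-1 {π = π} perm cut)
    ρ-perm = proj₁ (proj₂ (cut-at-1 {π = π} perm cut))
    π≡ = proj₂ (proj₂ (cut-at-1 {π = π} perm cut))
  ...   | no K≢1 = ∈-++⁺ʳ (map one-then (connected n)) (∈-concatFin⁺ (with-block n) j
                     (subst (_∈ with-block n j) (sym π≡) (∈-map⁺ (then-decreasing j) σ∈)))
    where
    block = later-first-cut {π = π} perm ok K (ℕP.≤∧≢⇒< 1≤K (λ e → K≢1 (sym e))) K≤n+1 cut no-earlier
    j = proj₁ block
    σ∈ = proj₁ (proj₂ (proj₂ block))
    π≡ = proj₂ (proj₂ (proj₂ block))

  -- No permutation is listed twice: 1 ⊖ ρ is cut at 1 while σ ⊖ δⱼ is not,
  -- the block size j is determined, and both gluings are injective.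
  connected-unique : ∀ n → Unique (connected n)
  connected-unique zero = []ᴬ ∷ᴾ []ᴾ
  connected-unique (suc n) = Unique.++⁺
    (Unique.map⁺ (λ {ρ} {ρ′} e → proj₂ (SkewSum.skew-inj {1} {n} refl {decreasing 1} {decreasing 1} {ρ} {ρ′} e)) (connected-unique n))
    (concatFin-unique (with-block n)
      (λ j → Unique.map⁺ (λ {σ} {σ′} e → proj₁ (SkewSum.skew-inj (sizes j) {σ} {σ′} e)) (indecomposables-unique _))
      λ j j′ π∈ π∈′ → same-size j j′ (∈-map⁻ (then-decreasing j) π∈) (∈-map⁻ (then-decreasing j′) π∈′))
    λ (π∈one , π∈blocks) → not-both (∈-map⁻ one-then π∈one) (∈-concatFin⁻ (with-block n) π∈blocks)
    where
    same-size : ∀ j j′ {π} → (∃ λ σ → σ ∈ indecomposables _ × π ≡ then-decreasing j σ) →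
                (∃ λ σ → σ ∈ indecomposables _ × π ≡ then-decreasing j′ σ) → j ≡ j′
    same-size j j′ (σ , σ∈ , refl) (σ′ , σ′∈ , same) =
      FinP.toℕ-injective (ℕP.∸-cancelˡ-≡ (ℕP.≤-trans (ℕP.<⇒≤ (FinP.toℕ<n j)) (ℕP.n≤1+n n))
        (ℕP.≤-trans (ℕP.<⇒≤ (FinP.toℕ<n j′)) (ℕP.n≤1+n n))
        (first-block-size-unique (sizes j) (sizes j′) (proj₂ (∈-indecomposables⁻ σ∈)) (proj₂ (∈-indecomposables⁻ σ′∈))
          (ℕP.<-≤-trans (s≤s z≤n) (2≤size j)) (ℕP.<-≤-trans (s≤s z≤n) (2≤size j′)) same))
    not-both : ∀ {π} → (∃ λ ρ → ρ ∈ connected n × π ≡ one-then ρ) → (Σ (Fin n) λ j → π ∈ with-block n j) → ⊥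
    not-both (ρ , _ , refl) (j , π∈) with ∈-map⁻ (then-decreasing j) π∈
    ... | σ , σ∈ , same = proj₂ (∈-indecomposables⁻ σ∈) 1 (s≤s z≤n) (2≤size j)
          (SkewSum.skewCut-left⁻ (sizes j) σ (decreasing (toℕ j)) 1 (ℕP.<⇒≤ (2≤size j))
            (subst (λ w → SkewCut w 1) same (SkewSum.skewCut-middle {1} {n} refl (decreasing 1) ρ)))

module Coefficients where

  open ListCounting using (sumFin)
  open Indecomposables using (indecCount; module FirstBlock)
  open import Data.Nat as ℕ using (ℕ; zero; suc; _∸_; _!; _<_; z≤n; s≤s)
  import Data.Nat.Properties as ℕP
  open import Data.Integer as ℤ using (ℤ; +_; -_; _+_; _*_)
  import Data.Integer.Properties as ℤP
  open import Data.Integer.Tactic.RingSolver using (solve-∀)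
  open import Data.Fin using (toℕ)
  open import Data.List using (List; _∷_; map; zipWith; upTo; applyUpTo)
  open import Relation.Binary.PropositionalEquality
  open import Function using (_∘_; id)

  sumTo : ℕ → (ℕ → ℤ) → ℤ
  sumTo zero h = + 0
  sumTo (suc n) h = h 0 + sumTo n (h ∘ suc)

  sumℤ-applyUpTo : ∀ h n → sumℤ (applyUpTo h n) ≡ sumTo n h
  sumℤ-applyUpTo h zero = refl
  sumℤ-applyUpTo h (suc n) = cong (λ t → h 0 + t) (sumℤ-applyUpTo (h ∘ suc) n)

  zipWith-applyUpTo : ∀ {A B C : Set} (g : A → B → C) a b n →
    zipWith g (applyUpTo a n) (applyUpTo b n) ≡ applyUpTo (λ j → g (a j) (b j)) n
  zipWith-applyUpTo g a b zero = refl
  zipWith-applyUpTo g a b (suc n) = cong (_ ∷_) (zipWith-applyUpTo g (a ∘ suc) (b ∘ suc) n)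

  map-applyUpTo : ∀ {A B : Set} (g : A → B) a n → map g (applyUpTo a n) ≡ applyUpTo (g ∘ a) n
  map-applyUpTo g a zero = refl
  map-applyUpTo g a (suc n) = cong (_ ∷_) (map-applyUpTo g (a ∘ suc) n)

  sumFin-toℤ : ∀ n (h : ℕ → ℕ) → + sumFin n (h ∘ toℕ) ≡ sumTo n (λ j → + h j)
  sumFin-toℤ zero h = refl
  sumFin-toℤ (suc n) h = trans (ℤP.pos-+ (h 0) _) (cong (λ t → + h 0 + t) (sumFin-toℤ n (h ∘ suc)))

  sumTo-last : ∀ n h → sumTo (suc n) h ≡ sumTo n h + h n
  sumTo-last zero h = ℤP.+-comm (h 0) (+ 0)
  sumTo-last (suc n) h = trans (cong (λ t → h 0 + t) (sumTo-last n (h ∘ suc))) (sym (ℤP.+-assoc (h 0) _ _))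

  sumTo-cong : ∀ n {h h′} → (∀ j → j < n → h j ≡ h′ j) → sumTo n h ≡ sumTo n h′
  sumTo-cong zero e = refl
  sumTo-cong (suc n) e = cong₂ _+_ (e 0 (s≤s z≤n)) (sumTo-cong n λ j j<n → e (suc j) (s≤s j<n))

  sumTo-+ : ∀ n h h′ → sumTo n (λ j → h j + h′ j) ≡ sumTo n h + sumTo n h′
  sumTo-+ zero h h′ = refl
  sumTo-+ (suc n) h h′ = trans (cong (λ t → (h 0 + h′ 0) + t) (sumTo-+ n (h ∘ suc) (h′ ∘ suc)))
    (interchange (h 0) (h′ 0) (sumTo n (h ∘ suc)) (sumTo n (h′ ∘ suc)))
    where
    interchange : ∀ a b c d → (a + b) + (c + d) ≡ (a + c) + (b + d)
    interchange = solve-∀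

  sumTo-neg : ∀ n h → sumTo n (λ j → - h j) ≡ - sumTo n h
  sumTo-neg zero h = refl
  sumTo-neg (suc n) h = trans (cong (λ t → - h 0 + t) (sumTo-neg n (h ∘ suc))) (sym (ℤP.neg-distrib-+ (h 0) _))

  sumTo-reverse : ∀ n h → sumTo n h ≡ sumTo n (λ j → h (n ∸ suc j))
  sumTo-reverse zero h = refl
  sumTo-reverse (suc n) h = begin
    h 0 + sumTo n (h ∘ suc)                       ≡⟨ cong (λ t → h 0 + t) (sumTo-reverse n (h ∘ suc)) ⟩
    h 0 + sumTo n (λ j → h (suc (n ∸ suc j)))     ≡⟨ cong (λ t → h 0 + t) (sumTo-cong n λ j j<n → cong h (sym (ℕP.+-∸-assoc 1 j<n))) ⟩
    h 0 + sumTo n (λ j → h (n ∸ j))               ≡⟨ ℤP.+-comm (h 0) _ ⟩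
    sumTo n (λ j → h (n ∸ j)) + h 0               ≡⟨ cong (λ t → sumTo n (λ j → h (n ∸ j)) + h t) (ℕP.n∸n≡0 n) ⟨
    sumTo n (λ j → h (n ∸ j)) + h (n ∸ n)         ≡⟨ sumTo-last n (λ j → h (n ∸ j)) ⟨
    sumTo (suc n) (λ j → h (n ∸ j))               ∎
    where open ≡-Reasoning

  -- The coefficients of 1 / Σ k! xᵏ are 1, −f(1), −f(2), …, where f counts
  -- indecomposable permutations.
  inverseCoeff : ℕ → ℤ
  inverseCoeff zero = + 1
  inverseCoeff (suc i) = - + indecCount (suc i)

  nextInverse : ℕ → List ℤ → ℤ
  nextInverse n prev = - sumℤ (zipWith (λ j b → + ((suc j) !) * b) (upTo (suc n)) prev)

  -- The recurrence b(n+1) = −Σ_{j≤n} (j+1)!·b(n−j) holds for b = inverseCoeff: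
  -- it is the first-block decomposition (n+1)! = f(n+1) + Σ_{j<n} f(n−j)·(j+1)!.
  nextInverse-inverseCoeff : ∀ n → nextInverse n (applyUpTo (λ j → inverseCoeff (n ∸ j)) (suc n)) ≡ inverseCoeff (suc n)
  nextInverse-inverseCoeff n = begin
    nextInverse n (applyUpTo (λ j → inverseCoeff (n ∸ j)) (suc n))
      ≡⟨ cong (λ l → - sumℤ l) (zipWith-applyUpTo (λ j b → + ((suc j) !) * b) id (λ j → inverseCoeff (n ∸ j)) (suc n)) ⟩
    - sumℤ (applyUpTo term (suc n))        ≡⟨ cong -_ (sumℤ-applyUpTo term (suc n)) ⟩
    - sumTo (suc n) term                   ≡⟨ cong -_ (sumTo-last n term) ⟩
    - (sumTo n term + term n)              ≡⟨ cong (λ t → - (t + term n)) (sumTo-cong n term<n) ⟩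
    - (sumTo n (λ j → - + block j) + term n) ≡⟨ cong (λ t → - (t + term n)) (sumTo-neg n (λ j → + block j)) ⟩
    - (- S + term n)                       ≡⟨ cong (λ t → - (- S + t)) term-n ⟩
    - (- S + + ((suc n) !))                  ≡⟨ cong (λ t → - (- S + t)) decomposition ⟩
    - (- S + (+ indecCount (suc n) + S))   ≡⟨ cancel S (+ indecCount (suc n)) ⟩
    - + indecCount (suc n)                 ∎
    where
    open ≡-Reasoning
    term : ℕ → ℤ
    term j = + ((suc j) !) * inverseCoeff (n ∸ j)
    block : ℕ → ℕ
    block j = (suc j) ! ℕ.* indecCount (n ∸ j)
    S : ℤ
    S = sumTo n (λ j → + block j)
    n∸j : ∀ j → j < n → n ∸ j ≡ suc (n ∸ suc j)
    n∸j j (s≤s j<n) = ℕP.+-∸-assoc 1 j<n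
    term<n : ∀ j → j < n → term j ≡ - + block j
    term<n j j<n = begin
      + ((suc j) !) * inverseCoeff (n ∸ j)      ≡⟨ cong (λ t → + ((suc j) !) * inverseCoeff t) (n∸j j j<n) ⟩
      + ((suc j) !) * - + indecCount (suc (n ∸ suc j)) ≡⟨ cong (λ t → + ((suc j) !) * - + indecCount t) (n∸j j j<n) ⟨
      + ((suc j) !) * - + indecCount (n ∸ j)    ≡⟨ ℤP.neg-distribʳ-* (+ ((suc j) !)) _ ⟨
      - (+ ((suc j) !) * + indecCount (n ∸ j))  ≡⟨ cong -_ (ℤP.pos-* ((suc j) !) (indecCount (n ∸ j))) ⟨
      - + block j                               ∎
    term-n : term n ≡ + ((suc n) !)
    term-n = trans (cong (λ t → + ((suc n) !) * inverseCoeff t) (ℕP.n∸n≡0 n)) (ℤP.*-identityʳ _)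
    decomposition : + ((suc n) !) ≡ + indecCount (suc n) + S
    decomposition = begin
      + ((suc n) !)   ≡⟨ cong +_ (FirstBlock.factorial-decomposition n) ⟩
      + (indecCount (suc n) ℕ.+ sumFin n (λ j → indecCount (n ∸ toℕ j) ℕ.* (suc (toℕ j)) !))
                    ≡⟨ ℤP.pos-+ (indecCount (suc n)) _ ⟩
      + indecCount (suc n) + + sumFin n (λ j → indecCount (n ∸ toℕ j) ℕ.* (suc (toℕ j)) !)
                    ≡⟨ cong (λ t → + indecCount (suc n) + t)
                         (trans (sumFin-toℤ n (λ j → indecCount (n ∸ j) ℕ.* (suc j) !))
                                (sumTo-cong n λ j _ → cong +_ (ℕP.*-comm (indecCount (n ∸ j)) ((suc j) !)))) ⟩
      + indecCount (suc n) + S ∎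
    cancel : ∀ x y → - (- x + (y + x)) ≡ - y
    cancel = solve-∀

  invRev-closed : ∀ n → invRev n ≡ applyUpTo (λ j → inverseCoeff (n ∸ j)) (suc n)
  invRev-closed zero = refl
  invRev-closed (suc n) = begin
    nextInverse n (invRev n) ∷ invRev n     ≡⟨ cong (λ l → nextInverse n l ∷ l) (invRev-closed n) ⟩
    nextInverse n prev ∷ prev               ≡⟨ cong (_∷ prev) (nextInverse-inverseCoeff n) ⟩
    inverseCoeff (suc n) ∷ prev             ∎
    where
    open ≡-Reasoning
    prev = applyUpTo (λ j → inverseCoeff (n ∸ j)) (suc n)

  invCoeff-closed : ∀ n → invCoeff n ≡ inverseCoeff n
  invCoeff-closed n rewrite invRev-closed n = refl

  -- gⱼ = [xʲ](F(x) − x) is 0, 0, f(2), f(3), …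
  shiftedF : ℕ → ℤ
  shiftedF j = F-coeff j ℤ.- δ 1 j

  shiftedF-from-2 : ∀ i → shiftedF (suc (suc i)) ≡ + indecCount (suc (suc i))
  shiftedF-from-2 i = trans (cong (λ t → (+ 0 ℤ.- t) ℤ.- + 0) (invCoeff-closed (suc (suc i)))) (simplify _)
    where
    simplify : ∀ x → (+ 0 ℤ.- (- x)) ℤ.- + 0 ≡ x
    simplify = solve-∀

  -- Division by (1 − x)² weights gⱼ by n + 1 − j in the n-th coefficient.
  weighted : ℕ → ℤ
  weighted n = sumTo (suc n) (λ j → + suc (n ∸ j) * shiftedF j)

  GF-coeff-weighted : ∀ n → GF-coeff n ≡ weighted n + + 1
  GF-coeff-weighted n = cong (_+ + 1) (trans
    (cong sumℤ (map-applyUpTo (λ j → + suc (n ∸ j) * shiftedF j) id (suc n)))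
    (sumℤ-applyUpTo (λ j → + suc (n ∸ j) * shiftedF j) (suc n)))

  -- Increasing n raises every weight by one and adds a new term of weight 1.
  weighted-step : ∀ n → weighted (suc n) ≡ weighted n + sumTo (suc (suc n)) shiftedF
  weighted-step n = begin
    weighted (suc n)                               ≡⟨ sumTo-last (suc n) term ⟩
    sumTo (suc n) term + term (suc n)              ≡⟨ cong₂ _+_ (sumTo-cong (suc n) term<) term-last ⟩
    sumTo (suc n) (λ j → + suc (n ∸ j) * shiftedF j + shiftedF j) + shiftedF (suc n)
                                                   ≡⟨ cong (_+ shiftedF (suc n)) (sumTo-+ (suc n) (λ j → + suc (n ∸ j) * shiftedF j) shiftedF) ⟩
    (weighted n + sumTo (suc n) shiftedF) + shiftedF (suc n)
                                                   ≡⟨ ℤP.+-assoc (weighted n) _ _ ⟩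
    weighted n + (sumTo (suc n) shiftedF + shiftedF (suc n))
                                                   ≡⟨ cong (λ t → weighted n + t) (sumTo-last (suc n) shiftedF) ⟨
    weighted n + sumTo (suc (suc n)) shiftedF      ∎
    where
    open ≡-Reasoning
    term : ℕ → ℤ
    term j = + suc (suc n ∸ j) * shiftedF j
    one-more : ∀ y x → (+ 1 + y) * x ≡ y * x + x
    one-more = solve-∀
    term< : ∀ j → j < suc n → term j ≡ + suc (n ∸ j) * shiftedF j + shiftedF j
    term< j (s≤s j≤n) = trans (cong (λ t → + suc t * shiftedF j) (ℕP.+-∸-assoc 1 j≤n)) (one-more (+ suc (n ∸ j)) (shiftedF j))
    term-last : term (suc n) ≡ shiftedF (suc n)
    term-last = trans (cong (λ t → + suc t * shiftedF (suc n)) (ℕP.n∸n≡0 n)) (ℤP.*-identityˡ _)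

  sumTo-shiftedF : ∀ n → sumTo (suc (suc n)) shiftedF ≡ + sumFin n (λ j → indecCount (suc n ∸ toℕ j))
  sumTo-shiftedF n = begin
    sumTo (suc (suc n)) shiftedF                      ≡⟨⟩
    + 0 + (+ 0 + sumTo n (shiftedF ∘ suc ∘ suc))      ≡⟨ trans (ℤP.+-identityˡ _) (ℤP.+-identityˡ _) ⟩
    sumTo n (shiftedF ∘ suc ∘ suc)                    ≡⟨ sumTo-cong n (λ i _ → shiftedF-from-2 i) ⟩
    sumTo n (λ i → + indecCount (suc (suc i)))        ≡⟨ sumTo-reverse n _ ⟩
    sumTo n (λ j → + indecCount (suc (suc (n ∸ suc j)))) ≡⟨ sumTo-cong n (λ j j<n → cong (+_ ∘ indecCount) (from-top j j<n)) ⟩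
    sumTo n (λ j → + indecCount (suc n ∸ j))          ≡⟨ sumFin-toℤ n (λ j → indecCount (suc n ∸ j)) ⟨
    + sumFin n (λ j → indecCount (suc n ∸ toℕ j))     ∎
    where
    open ≡-Reasoning
    from-top : ∀ j → j < n → suc (suc (n ∸ suc j)) ≡ suc n ∸ j
    from-top j (s≤s j<n) = trans (cong suc (sym (ℕP.+-∸-assoc 1 j<n))) (sym (ℕP.+-∸-assoc 1 (ℕP.<⇒≤ (s≤s j<n))))

  GF-coeff-step : ∀ n → GF-coeff (suc n) ≡ GF-coeff n + + sumFin n (λ j → indecCount (suc n ∸ toℕ j))
  GF-coeff-step n = begin
    GF-coeff (suc n)                              ≡⟨ GF-coeff-weighted (suc n) ⟩
    weighted (suc n) + + 1                        ≡⟨ cong (_+ + 1) (weighted-step n) ⟩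
    (weighted n + sumTo (suc (suc n)) shiftedF) + + 1 ≡⟨ swap (weighted n) _ ⟩
    (weighted n + + 1) + sumTo (suc (suc n)) shiftedF ≡⟨ cong₂ _+_ (sym (GF-coeff-weighted n)) (sumTo-shiftedF n) ⟩
    GF-coeff n + + sumFin n (λ j → indecCount (suc n ∸ toℕ j)) ∎
    where
    open ≡-Reasoning
    swap : ∀ a b → (a + b) + + 1 ≡ (a + + 1) + b
    swap = solve-∀

open import Data.Nat using (ℕ; zero; suc; _∸_)
import Data.Nat as ℕ
open import Data.Integer using (+_)
import Data.Integer as ℤ
import Data.Integer.Properties as ℤP
open import Data.Fin using (toℕ)
open import Data.List using (List; length)
open import Data.List.Membership.Propositional using (_∈_)
open import Data.List.Relation.Unary.Unique.Propositional using (Unique)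
open import Data.Product using (Σ; _×_; _,_)
open import Function.Bundles using (_⇔_; mk⇔)
open import Function.Construct.Composition using (_⇔-∘_)
open import Function.Construct.Symmetry using (⇔-sym)
open import Relation.Binary.PropositionalEquality using (_≡_; refl; cong; module ≡-Reasoning)
open OccurrenceGraph
open PatternAvoidance
open ListCounting
open Indecomposables
open ConnectedPermutations
open Coefficients

-- G₁₂(π) is connected iff π avoids m: both say that π has no bad cut.
connected⇔avoids : ∀ n (π : Word n) → IsPerm π → Connected π ⇔ Avoids m3412 π
connected⇔avoids n π perm = ⇔-sym (avoids⇔noBadCut {π = π} perm) ⇔-∘ connected⇔noBadCut {π = π} perm

∈-connected : ∀ n (π : Word n) → π ∈ connected n ⇔ (IsPerm π × Connected π)
∈-connected n π = mk⇔
  (λ π∈ → let (perm , ok) = connected-sound n π∈ in perm , noBadCut⇒connected {π = π} perm ok)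
  (λ (perm , conn) → connected-complete n perm (connected⇒noBadCut {π = π} conn))

-- The list has the length predicted by the generating function: both
-- satisfy the same recurrence.
count-connected : ∀ n → + length (connected n) ≡ GF-coeff n
count-connected zero = refl
count-connected (suc n) = begin
  + length (connected (suc n))          ≡⟨ cong +_ (length-connected n) ⟩
  + (length (connected n) ℕ.+ new)      ≡⟨ ℤP.pos-+ (length (connected n)) new ⟩
  + length (connected n) ℤ.+ + new      ≡⟨ cong (ℤ._+ + new) (count-connected n) ⟩
  GF-coeff n ℤ.+ + new                  ≡⟨ GF-coeff-step n ⟨
  GF-coeff (suc n)                      ∎
  where
  open ≡-Reasoning
  new = sumFin n (λ j → indecCount (suc n ∸ toℕ j))

theorem6p1 :
    (∀ (n : ℕ) (π : Word n) → IsPerm π → (Connected π ⇔ Avoids m3412 π))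
    ×
    (∀ (n : ℕ) → Σ (List (Word n)) λ L →
        Unique L
        × (∀ (π : Word n) → (π ∈ L) ⇔ (IsPerm π × Connected π))
        × (+ length L ≡ GF-coeff n))
theorem6p1 = connected⇔avoids ,
  λ n → connected n , connected-unique n , ∈-connected n , count-connected n
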